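{- Let $G=(V,E)$ be an undirected graph without isolated vertices, and consider its Vertex Cover set system. For a vertex $v$, let $G_v$ be the subgraph of $G$ induced by the neighbors of $v$ (not including $v$). Then $\alpha_v=\nu(\mathbf 1_v)$ equals the fractional clique number of $G_v$, and thus also the fractional chromatic number of $G_v$.
   Context: The Vertex Cover set system of $G$ has agents $V$ and feasible sets all vertex covers of $G$. $\mathbf 1_v$ is the cost vector with cost $1$ on $v$ and $0$ on all other vertices. For a cost vector $c$, let $S$ be the cheapest vertex cover w.r.t. $c$ (ties broken lexicographically) and $\nu(c)$ the optimal value of the LP: maximize $\sum_{u\in S}x_u$ s.t. $x_u\ge c_u$ for all $u$, $x_u=c_u$ for $u\notin S$, $\sum_{u\in S}x_u\le\sum_{u\in T}x_u$ for all vertex covers $T$. The fractional clique number of a graph is the maximum of $\sum_u x_u$ subject to $x_u\ge0$ and $\sum_{u\in I}x_u\le1$ for every independent set $I$; the fractional chromatic number is the optimum of the dual LP.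
   Formalization: The variables of the linear programs defining ν(1_v), the fractional clique number and the fractional chromatic number of G_v take only rational values. -}

module Defs where

open import Data.Bool using (Bool; true; false; if_then_else_)
open import Data.Nat using (ℕ; zero; suc)
open import Data.Fin using (Fin; _≟_)
open import Data.Vec using (Vec; []; _∷_; lookup)
open import Data.List using (List; []; _∷_; map; _++_; foldr; allFin)
open import Data.Fin.Subset using (Subset; _∈_; _∉_; _⊆_)
open import Data.Rational using (ℚ; 0ℚ; 1ℚ; _+_; _≤_)
open import Data.Product using (Σ; _×_; ∃)
open import Data.Sum using (_⊎_)
open import Relation.Nullary using (¬_; yes; no)
open import Relation.Binary.PropositionalEquality using (_≡_)

record Graph (n : ℕ) : Set where
  field
    adj   : Fin n → Fin n → Bool
    sym   : ∀ u w → adj u w ≡ adj w u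
    irrefl : ∀ u → adj u u ≡ false

open Graph public

Edge : ∀ {n} → Graph n → Fin n → Fin n → Set
Edge G u w = adj G u w ≡ true

NoIsolatedVertices : ∀ {n} → Graph n → Set
NoIsolatedVertices {n} G = ∀ (v : Fin n) → ∃ λ w → Edge G v w

Nbhd : ∀ {n} → Graph n → Fin n → Subset n
Nbhd {n} G v = Data.Vec.tabulate (adj G v)

Σℚ : List ℚ → ℚ
Σℚ = foldr _+_ 0ℚ

weight : ∀ {n} → (Fin n → ℚ) → Subset n → ℚ
weight {n} x T = Σℚ (map (λ u → if lookup T u then x u else 0ℚ) (allFin n))

allSubsets : ∀ n → List (Subset n)
allSubsets zero = [] ∷ []
allSubsets (suc n) = map (true ∷_) (allSubsets n) ++ map (false ∷_) (allSubsets n)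

IsVertexCover : ∀ {n} → Graph n → Subset n → Set
IsVertexCover G T = ∀ u w → Edge G u w → u ∈ T ⊎ w ∈ T

IsIndependent : ∀ {n} → Graph n → Subset n → Set
IsIndependent G I = ∀ u w → u ∈ I → w ∈ I → ¬ Edge G u w

IsMaxValue : {X : Set} → (X → Set) → (X → ℚ) → ℚ → Set
IsMaxValue {X} Feasible obj q =
  (Σ X λ x → Feasible x × obj x ≡ q) × (∀ x → Feasible x → obj x ≤ q)

IsMinValue : {X : Set} → (X → Set) → (X → ℚ) → ℚ → Set
IsMinValue {X} Feasible obj q =
  (Σ X λ x → Feasible x × obj x ≡ q) × (∀ x → Feasible x → q ≤ obj x)

𝟙 : ∀ {n} → Fin n → Fin n → ℚ
𝟙 v u with v ≟ u
... | yes _ = 1ℚ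
... | no _  = 0ℚ

data _≤lex_ : ∀ {n} → Subset n → Subset n → Set where
  []≤    : [] ≤lex []
  here<  : ∀ {n} {S T : Subset n} → (false ∷ S) ≤lex (true ∷ T)
  there≤ : ∀ {n} b {S T : Subset n} → S ≤lex T → (b ∷ S) ≤lex (b ∷ T)

IsChosenCover : ∀ {n} → Graph n → (Fin n → ℚ) → Subset n → Set
IsChosenCover G c S =
  IsVertexCover G S
  × (∀ T → IsVertexCover G T → weight c S ≤ weight c T)
  × (∀ T → IsVertexCover G T → weight c T ≡ weight c S → S ≤lex T)

NuFeasible : ∀ {n} → Graph n → (Fin n → ℚ) → Subset n → (Fin n → ℚ) → Set
NuFeasible G c S x =
  (∀ u → c u ≤ x u)
  × (∀ u → u ∉ S → x u ≡ c u)
  × (∀ T → IsVertexCover G T → weight x S ≤ weight x T)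

IsNu : ∀ {n} → Graph n → (Fin n → ℚ) → Subset n → ℚ → Set
IsNu G c S q = IsMaxValue (NuFeasible G c S) (λ x → weight x S) q

-- Fractional clique / chromatic number of the induced subgraph G[W].
-- Weights on vertices outside W (resp. on sets that are not independent
-- subsets of W) play no role / are forced to 0.

FracCliqueFeasible : ∀ {n} → Graph n → Subset n → (Fin n → ℚ) → Set
FracCliqueFeasible G W x =
  (∀ u → u ∈ W → 0ℚ ≤ x u)
  × (∀ I → I ⊆ W → IsIndependent G I → weight x I ≤ 1ℚ)

IsFracCliqueNumber : ∀ {n} → Graph n → Subset n → ℚ → Set
IsFracCliqueNumber G W q = IsMaxValue (FracCliqueFeasible G W) (λ x → weight x W) q

FracColFeasible : ∀ {n} → Graph n → Subset n → (Subset n → ℚ) → Set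
FracColFeasible {n} G W y =
  (∀ I → 0ℚ ≤ y I)
  × (∀ I → ¬ (I ⊆ W × IsIndependent G I) → y I ≡ 0ℚ)
  × (∀ u → u ∈ W →
       1ℚ ≤ Σℚ (map (λ I → if lookup I u then y I else 0ℚ) (allSubsets n)))

IsFracChromaticNumber : ∀ {n} → Graph n → Subset n → ℚ → Set
IsFracChromaticNumber {n} G W q =
  IsMinValue (FracColFeasible G W) (λ y → Σℚ (map y (allSubsets n))) q

module Submission where

-- FourierMotzkin proves LP duality for maximising one coordinate of a
-- finite system of linear inequalities by eliminating the other variables: a
-- bounded feasible system has a nonnegative combination of its rows reading
-- x t₀ ≤ β with β attained.  FractionalClique applies it to the clique LP, which
-- yields a fractional clique and a fractional colouring of equal weight, both
-- optimal by weak duality.  Neighbourhood shows v ∉ S ⊇ N(v); weight 1 on v plus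
-- an optimal clique on N(v) is ν-feasible with value α, and exchanging an
-- independent I ⊆ S for its neighbours shows no ν-feasible point exceeds α.

open import Data.Fin using (Fin)
open import Data.Fin.Subset using (Subset)
open import Data.Nat using (ℕ)
open import Data.Product using (Σ; _×_; _,_)
open import Data.Rational using (ℚ)
open import Defs using (Graph; NoIsolatedVertices; IsChosenCover; 𝟙; IsNu; Nbhd;
  IsFracCliqueNumber; IsFracChromaticNumber)

module FiniteSums where
  open import Data.Bool using (if_then_else_)
  open import Data.Empty using (⊥-elim)
  open import Data.Fin using (Fin; zero; suc; _≟_)
  open import Data.Fin.Properties using (suc-injective)
  open import Data.List using (List; []; _∷_; map; _++_; allFin; tabulate)
  open import Data.List.Membership.Propositional using (_∈_)
  import Data.List.Membership.DecPropositional
  open import Data.List.Relation.Unary.Any using (here; there)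
  open import Data.Nat using (ℕ)
  open import Data.Rational using (ℚ; 0ℚ; 1ℚ; _+_; _*_; -_; _≤_)
  open import Data.Rational.Properties hiding (_≟_)
  open import Data.Rational.Solver using (module +-*-Solver)
  open import Function using (_∘_)
  open import Relation.Binary.Definitions using (DecidableEquality)
  open import Relation.Binary.PropositionalEquality
  open import Relation.Nullary using (yes; no; does)
  open import Defs using (Σℚ)
  open +-*-Solver using (solve; _:+_; _:=_)

  ∑ : ∀ {A : Set} → List A → (A → ℚ) → ℚ
  ∑ L f = Σℚ (map f L)

  module _ {A : Set} where

    ∑-cong : ∀ (L : List A) {f g : A → ℚ} → (∀ a → f a ≡ g a) → ∑ L f ≡ ∑ L g
    ∑-cong [] f≡g = refl
    ∑-cong (a ∷ L) f≡g = cong₂ _+_ (f≡g a) (∑-cong L f≡g)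

    ∑-cong-∈ : ∀ (L : List A) {f g : A → ℚ} → (∀ a → a ∈ L → f a ≡ g a) → ∑ L f ≡ ∑ L g
    ∑-cong-∈ [] f≡g = refl
    ∑-cong-∈ (a ∷ L) f≡g = cong₂ _+_ (f≡g a (here refl)) (∑-cong-∈ L (λ b b∈L → f≡g b (there b∈L)))

    ∑-zero : ∀ (L : List A) → ∑ L (λ _ → 0ℚ) ≡ 0ℚ
    ∑-zero [] = refl
    ∑-zero (a ∷ L) = trans (+-identityˡ _) (∑-zero L)

    ∑-+ : ∀ (L : List A) (f g : A → ℚ) → ∑ L (λ a → f a + g a) ≡ ∑ L f + ∑ L g
    ∑-+ [] f g = refl
    ∑-+ (a ∷ L) f g = trans (cong (f a + g a +_) (∑-+ L f g))
      (solve 4 (λ p q r s → (p :+ q) :+ (r :+ s) := (p :+ r) :+ (q :+ s)) refl (f a) (g a) (∑ L f) (∑ L g))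

    ∑-* : ∀ (L : List A) (c : ℚ) (f : A → ℚ) → ∑ L (λ a → c * f a) ≡ c * ∑ L f
    ∑-* [] c f = sym (*-zeroʳ c)
    ∑-* (a ∷ L) c f = trans (cong (c * f a +_) (∑-* L c f)) (sym (*-distribˡ-+ c (f a) (∑ L f)))

    ∑-*-zero : ∀ (L : List A) (f : A → ℚ) → ∑ L (λ a → f a * 0ℚ) ≡ 0ℚ
    ∑-*-zero L f = trans (∑-cong L (λ a → *-zeroʳ (f a))) (∑-zero L)

    ∑-neg : ∀ (L : List A) (f : A → ℚ) → ∑ L (λ a → - f a) ≡ - ∑ L f
    ∑-neg [] f = refl
    ∑-neg (a ∷ L) f = trans (cong (- f a +_) (∑-neg L f)) (sym (neg-distrib-+ (f a) (∑ L f)))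

    ∑-mono : ∀ (L : List A) {f g : A → ℚ} → (∀ a → f a ≤ g a) → ∑ L f ≤ ∑ L g
    ∑-mono [] f≤g = ≤-refl
    ∑-mono (a ∷ L) f≤g = +-mono-≤ (f≤g a) (∑-mono L f≤g)

    ∑-++ : ∀ (L M : List A) (f : A → ℚ) → ∑ (L ++ M) f ≡ ∑ L f + ∑ M f
    ∑-++ [] M f = sym (+-identityˡ _)
    ∑-++ (a ∷ L) M f = trans (cong (f a +_) (∑-++ L M f)) (sym (+-assoc (f a) (∑ L f) (∑ M f)))

  ∑-map : ∀ {A B : Set} (L : List A) (h : A → B) (f : B → ℚ) → ∑ (map h L) f ≡ ∑ L (f ∘ h)
  ∑-map [] h f = refl
  ∑-map (a ∷ L) h f = cong (f (h a) +_) (∑-map L h f)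

  ∑-swap : ∀ {A B : Set} (L : List A) (M : List B) (F : A → B → ℚ) →
    ∑ L (λ a → ∑ M (F a)) ≡ ∑ M (λ b → ∑ L (λ a → F a b))
  ∑-swap [] M F = sym (∑-zero M)
  ∑-swap (a ∷ L) M F = trans (cong (∑ M (F a) +_) (∑-swap L M F))
    (sym (∑-+ M (F a) (λ b → ∑ L (λ a′ → F a′ b))))

  ∑-tabulate : ∀ {B : Set} (n : ℕ) (h : Fin n → B) (f : B → ℚ) → ∑ (tabulate h) f ≡ ∑ (allFin n) (f ∘ h)
  ∑-tabulate ℕ.zero h f = refl
  ∑-tabulate (ℕ.suc n) h f =
    cong (f (h zero) +_) (trans (∑-tabulate n (h ∘ suc) f) (sym (∑-tabulate n suc (f ∘ h))))

  ∑-allFin-suc : ∀ n (f : Fin (ℕ.suc n) → ℚ) → ∑ (allFin (ℕ.suc n)) f ≡ f zero + ∑ (allFin n) (f ∘ suc)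
  ∑-allFin-suc n f = cong (f zero +_) (∑-tabulate n suc f)

  pick : ∀ {X : Set} → DecidableEquality X → X → (X → ℚ) → X → ℚ
  pick _≟X_ j g v = if does (j ≟X v) then g v else 0ℚ

  module _ {X : Set} (_≟X_ : DecidableEquality X) where

    pick-≡ : ∀ j g → pick _≟X_ j g j ≡ g j
    pick-≡ j g with j ≟X j
    ... | yes _ = refl
    ... | no j≢j = ⊥-elim (j≢j refl)

    pick-≢ : ∀ j g v → j ≢ v → pick _≟X_ j g v ≡ 0ℚ
    pick-≢ j g v j≢v with j ≟X v
    ... | yes j≡v = ⊥-elim (j≢v j≡v)
    ... | no _ = refl

    -- L lists every element of X exactly once, expressed as the sifting
    -- property of the Kronecker delta.  All sums over index sets in this
    -- development are sums over such enumerations.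
    Sifting : List X → Set
    Sifting L = ∀ j g → ∑ L (pick _≟X_ j g) ≡ g j

  module _ {X Y : Set} (_≟X_ : DecidableEquality X) (_≟Y_ : DecidableEquality Y)
           (h : X → Y) (h-injective : ∀ {a b} → h a ≡ h b → a ≡ b) where

    pick-image : ∀ j g a → pick _≟Y_ (h j) g (h a) ≡ pick _≟X_ j (g ∘ h) a
    pick-image j g a with j ≟X a
    ... | yes refl = pick-≡ _≟Y_ (h j) g
    ... | no j≢a = pick-≢ _≟Y_ (h j) g (h a) (j≢a ∘ h-injective)

    sifting-image : ∀ L → Sifting _≟X_ L → ∀ j g → ∑ (map h L) (pick _≟Y_ (h j) g) ≡ g (h j)
    sifting-image L sift j g = begin
      ∑ (map h L) (pick _≟Y_ (h j) g)   ≡⟨ ∑-map L h _ ⟩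
      ∑ L (pick _≟Y_ (h j) g ∘ h)       ≡⟨ ∑-cong L (pick-image j g) ⟩
      ∑ L (pick _≟X_ j (g ∘ h))         ≡⟨ sift j (g ∘ h) ⟩
      g (h j)                           ∎
      where open ≡-Reasoning

  sifting-miss : ∀ {X Y : Set} (_≟Y_ : DecidableEquality Y) (h : X → Y) (c : Y) →
    (∀ a → c ≢ h a) → ∀ (L : List X) g → ∑ (map h L) (pick _≟Y_ c g) ≡ 0ℚ
  sifting-miss _≟Y_ h c c∉img L g =
    trans (∑-map L h _) (trans (∑-cong L (λ a → pick-≢ _≟Y_ c g (h a) (c∉img a))) (∑-zero L))

  allFin-sifting : ∀ n → Sifting _≟_ (allFin n)
  allFin-sifting (ℕ.suc n) zero g = begin
    ∑ (allFin (ℕ.suc n)) (pick _≟_ zero g)         ≡⟨ ∑-allFin-suc n (pick _≟_ zero g) ⟩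
    g zero + ∑ (allFin n) (pick _≟_ zero g ∘ suc)  ≡⟨ cong (g zero +_) (∑-cong (allFin n) (λ i → pick-≢ _≟_ zero g (suc i) (λ ()))) ⟩
    g zero + ∑ (allFin n) (λ _ → 0ℚ)               ≡⟨ cong (g zero +_) (∑-zero (allFin n)) ⟩
    g zero + 0ℚ                                    ≡⟨ +-identityʳ (g zero) ⟩
    g zero                                         ∎
    where open ≡-Reasoning
  allFin-sifting (ℕ.suc n) (suc j) g = begin
    ∑ (allFin (ℕ.suc n)) (pick _≟_ (suc j) g)      ≡⟨ ∑-allFin-suc n (pick _≟_ (suc j) g) ⟩
    0ℚ + ∑ (allFin n) (pick _≟_ (suc j) g ∘ suc)   ≡⟨ +-identityˡ _ ⟩
    ∑ (allFin n) (pick _≟_ (suc j) g ∘ suc)        ≡⟨ ∑-cong (allFin n) (pick-image _≟_ _≟_ suc suc-injective j g) ⟩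
    ∑ (allFin n) (pick _≟_ j (g ∘ suc))            ≡⟨ allFin-sifting n j (g ∘ suc) ⟩
    g (suc j)                                      ∎
    where open ≡-Reasoning

  -- A sifting list contains every element: otherwise the delta at a missing
  -- element would sum to 0 rather than 1.
  sifting-complete : ∀ {X : Set} (_≟X_ : DecidableEquality X) {L} → Sifting _≟X_ L → ∀ x → x ∈ L
  sifting-complete _≟X_ {L} sift x with Data.List.Membership.DecPropositional._∈?_ _≟X_ x L
  ... | yes x∈L = x∈L
  ... | no x∉L = ⊥-elim (1≢0 (begin
    1ℚ                              ≡⟨ sym (sift x (λ _ → 1ℚ)) ⟩
    ∑ L (pick _≟X_ x (λ _ → 1ℚ))    ≡⟨ ∑-cong-∈ L (λ y y∈L → pick-≢ _≟X_ x _ y (λ { refl → x∉L y∈L })) ⟩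
    ∑ L (λ _ → 0ℚ)                  ≡⟨ ∑-zero L ⟩
    0ℚ                              ∎))
    where open ≡-Reasoning

module RationalFacts where
  open import Data.Empty using (⊥-elim)
  open import Data.List using (List; []; _∷_)
  open import Data.List.Membership.Propositional using (_∈_)
  open import Data.List.Relation.Unary.All using (lookup)
  open import Data.List.Relation.Unary.Any using (here; there)
  open import Data.Product using (Σ; _×_; _,_)
  open import Data.Rational
  open import Data.Rational.Properties
  open import Data.Rational.Solver using (module +-*-Solver)
  open import Data.Sum using ([_,_]′)
  open import Relation.Binary.Bundles using (DecTotalOrder)
  open import Relation.Binary.PropositionalEquality
  open import Relation.Nullary using (yes; no)
  open import Data.List.Extrema (DecTotalOrder.totalOrder ≤-decTotalOrder)
    using (argmin; argmax; argmin-sel; argmax-sel; f[argmin]≤f[⊤]; f[argmin]≤f[xs]; f[⊥]≤f[argmax]; f[xs]≤f[argmax])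
  open +-*-Solver using (solve; _:+_; _:-_; :-_; _:=_)

  0≤1 : 0ℚ ≤ 1ℚ
  0≤1 = <⇒≤ (positive⁻¹ 1ℚ)

  *-monoˡ-≤-≥0 : ∀ {a b} c → 0ℚ ≤ c → a ≤ b → c * a ≤ c * b
  *-monoˡ-≤-≥0 c 0≤c = *-monoˡ-≤-nonNeg c {{nonNegative 0≤c}}

  *-monoˡ-≤-≤0 : ∀ {a b} c → c ≤ 0ℚ → a ≤ b → c * b ≤ c * a
  *-monoˡ-≤-≤0 c c≤0 = *-monoˡ-≤-nonPos c {{nonPositive c≤0}}

  *-nonneg : ∀ {a b} → 0ℚ ≤ a → 0ℚ ≤ b → 0ℚ ≤ a * b
  *-nonneg {a} {b} 0≤a 0≤b = subst (_≤ a * b) (*-zeroʳ a) (*-monoˡ-≤-≥0 a 0≤a 0≤b)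

  +-nonneg : ∀ {a b} → 0ℚ ≤ a → 0ℚ ≤ b → 0ℚ ≤ a + b
  +-nonneg {a} {b} 0≤a 0≤b = subst (_≤ a + b) (+-identityʳ 0ℚ) (+-mono-≤ 0≤a 0≤b)

  *-cancelˡ-≤->0 : ∀ {a b} c → 0ℚ < c → c * a ≤ c * b → a ≤ b
  *-cancelˡ-≤->0 c 0<c = *-cancelˡ-≤-pos c {{positive 0<c}}

  ≤-‿⇒+≤ : ∀ {a b c} → a ≤ c - b → a + b ≤ c
  ≤-‿⇒+≤ {a} {b} {c} a≤c-b =
    subst (a + b ≤_) (solve 2 (λ c b → c :- b :+ b := c) refl c b) (+-monoˡ-≤ b a≤c-b)

  +≤+⇒-≤- : ∀ {a b c d} → a + b ≤ c + d → b - d ≤ c - a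
  +≤+⇒-≤- {a} {b} {c} {d} le = subst₂ _≤_
    (solve 4 (λ a b c d → a :+ b :+ (:- a :- d) := b :- d) refl a b c d)
    (solve 4 (λ a b c d → c :+ d :+ (:- a :- d) := c :- a) refl a b c d)
    (+-monoˡ-≤ (- a - d) le)

  -≤⇒-+≤ : ∀ {a b c} → b - c ≤ a → - a + b ≤ c
  -≤⇒-+≤ {a} {b} {c} le = subst₂ _≤_
    (solve 3 (λ a b c → b :- c :+ (:- a :+ c) := :- a :+ b) refl a b c)
    (solve 2 (λ a c → a :+ (:- a :+ c) := c) refl a c)
    (+-monoˡ-≤ (- a + c) le)

  -≤0⇒≤ : ∀ {a b} → a - b ≤ 0ℚ → a ≤ b
  -≤0⇒≤ {a} {b} a-b≤0 = subst₂ _≤_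
    (solve 2 (λ a b → a :- b :+ b := a) refl a b) (+-identityˡ b) (+-monoˡ-≤ b a-b≤0)

  neg≤0⇒0≤ : ∀ {a} → - a ≤ 0ℚ → 0ℚ ≤ a
  neg≤0⇒0≤ {a} -a≤0 = subst (0ℚ ≤_) (solve 1 (λ a → :- (:- a) := a) refl a) (neg-antimono-≤ -a≤0)

  ≤+nonneg : ∀ {a r} → 0ℚ ≤ r → a ≤ a + r
  ≤+nonneg {a} {r} 0≤r = subst (_≤ a + r) (+-identityʳ a) (+-monoʳ-≤ a 0≤r)

  ≤-exchange : ∀ {s t i c} → s ≤ t → t + i ≡ s + c → i ≤ c
  ≤-exchange {s} {t} {i} {c} s≤t t+i≡s+c = subst₂ _≤_
    (solve 2 (λ s i → s :+ i :- s := i) refl s i)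
    (trans (cong (_- s) t+i≡s+c) (solve 2 (λ s c → s :+ c :- s := c) refl s c))
    (+-monoˡ-≤ (- s) (+-monoˡ-≤ i s≤t))

  -- The multiplicative inverse, extended by inv 0 = 0 so that it is total.
  inv : ℚ → ℚ
  inv p with p ≟ 0ℚ
  ... | yes _ = 0ℚ
  ... | no p≢0 = (1/ p) {{≢-nonZero p≢0}}

  inv-cancel : ∀ p → p ≢ 0ℚ → inv p * p ≡ 1ℚ
  inv-cancel p p≢0 with p ≟ 0ℚ
  ... | yes p≡0 = ⊥-elim (p≢0 p≡0)
  ... | no p≢0′ = *-inverseˡ p {{≢-nonZero p≢0′}}

  inv-positive : ∀ p → 0ℚ < p → 0ℚ < inv p
  inv-positive p 0<p with p ≟ 0ℚ
  ... | yes refl = ⊥-elim (<-irrefl refl 0<p)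
  ... | no _ = positive⁻¹ _ {{1/pos⇒pos p {{positive 0<p}}}}

  module _ {A : Set} (f : A → ℚ) (a : A) (L : List A) where

    minimiser : Σ A λ m → m ∈ (a ∷ L) × (∀ {y} → y ∈ (a ∷ L) → f m ≤ f y)
    minimiser = argmin f a L , [ here , there ]′ (argmin-sel f a L) , below
      where
      below : ∀ {y} → y ∈ (a ∷ L) → f (argmin f a L) ≤ f y
      below (here refl) = f[argmin]≤f[⊤] {f = f} a L
      below (there y∈L) = lookup (f[argmin]≤f[xs] {f = f} a L) y∈L

    maximiser : Σ A λ m → m ∈ (a ∷ L) × (∀ {y} → y ∈ (a ∷ L) → f y ≤ f m)
    maximiser = argmax f a L , [ here , there ]′ (argmax-sel f a L) , above
      where
      above : ∀ {y} → y ∈ (a ∷ L) → f y ≤ f (argmax f a L)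
      above (here refl) = f[⊥]≤f[argmax] {f = f} a L
      above (there y∈L) = lookup (f[xs]≤f[argmax] {f = f} a L) y∈L

  interpolate : ∀ {A B : Set} (lo : A → ℚ) (hi : B → ℚ) (Ls : List A) (Hs : List B) →
    (∀ {q p} → q ∈ Ls → p ∈ Hs → lo q ≤ hi p) →
    Σ ℚ λ t → (∀ {q} → q ∈ Ls → lo q ≤ t) × (∀ {p} → p ∈ Hs → t ≤ hi p)
  interpolate lo hi Ls (p ∷ Hs) lo≤hi with minimiser hi p Hs
  ... | m , m∈ , m-min = hi m , (λ q∈ → lo≤hi q∈ m∈) , m-min
  interpolate lo hi (q ∷ Ls) [] lo≤hi with maximiser lo q Ls
  ... | m , m∈ , m-max = lo m , m-max , λ ()
  interpolate lo hi [] [] lo≤hi = 0ℚ , (λ ()) , (λ ())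

module SubsetFacts where
  open import Data.Bool using (Bool; true; false; if_then_else_)
  import Data.Bool as Bool
  open import Data.Empty using (⊥-elim)
  open import Data.Fin using (Fin; _≟_)
  open import Data.Fin.Properties using (all?)
  open import Data.Fin.Subset using (Subset; _∈_; ⁅_⁆)
  open import Data.Fin.Subset.Properties using (_∈?_; x∈⁅x⁆; x∈⁅y⁆⇒x≡y)
  open import Data.List using (List; map; _++_; allFin)
  open import Data.Nat using (ℕ)
  open import Data.Rational using (ℚ; 0ℚ; 1ℚ; _+_; _*_)
  open import Data.Rational.Properties using (+-identityʳ; +-identityˡ; *-identityˡ; *-zeroˡ)
  open import Data.Vec using ([]; _∷_; lookup)
  open import Data.Vec.Properties using (≡-dec; []=⇒lookup; lookup⇒[]=)
  open import Relation.Binary.Definitions using (DecidableEquality)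
  open import Relation.Binary.PropositionalEquality
  open import Relation.Nullary using (Dec; yes; no; ¬_; ¬?)
  open import Relation.Nullary.Decidable using (_→-dec_)
  open import Defs using (Graph; adj; irrefl; IsIndependent; weight; allSubsets)
  open FiniteSums

  false≢true : false ≢ true
  false≢true ()

  ⟦_⟧ : Bool → ℚ
  ⟦ k ⟧ = if k then 1ℚ else 0ℚ

  ⟦⟧-* : ∀ k a → ⟦ k ⟧ * a ≡ (if k then a else 0ℚ)
  ⟦⟧-* true a = *-identityˡ a
  ⟦⟧-* false a = *-zeroˡ a

  lookup⇒∈ : ∀ {n} {u : Fin n} {T : Subset n} → lookup T u ≡ true → u ∈ T
  lookup⇒∈ {u = u} {T} = lookup⇒[]= u T

  ∈⇒lookup : ∀ {n} {u : Fin n} {T : Subset n} → u ∈ T → lookup T u ≡ true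
  ∈⇒lookup = []=⇒lookup

  ∉⇒lookup : ∀ {n} {u : Fin n} {T : Subset n} → ¬ (u ∈ T) → lookup T u ≡ false
  ∉⇒lookup {u = u} {T} u∉T with lookup T u in T[u]
  ... | true = ⊥-elim (u∉T (lookup⇒∈ T[u]))
  ... | false = refl

  _≟ˢ_ : ∀ {n} → DecidableEquality (Subset n)
  _≟ˢ_ = ≡-dec Bool._≟_

  allSubsets-sifting : ∀ n → Sifting _≟ˢ_ (allSubsets n)
  allSubsets-sifting ℕ.zero [] g = +-identityʳ (g [])
  allSubsets-sifting (ℕ.suc n) (true ∷ I) g = begin
    ∑ (map (true ∷_) Ls ++ map (false ∷_) Ls) (pick _≟ˢ_ (true ∷ I) g)
      ≡⟨ ∑-++ (map (true ∷_) Ls) (map (false ∷_) Ls) _ ⟩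
    ∑ (map (true ∷_) Ls) (pick _≟ˢ_ (true ∷ I) g) + ∑ (map (false ∷_) Ls) (pick _≟ˢ_ (true ∷ I) g)
      ≡⟨ cong₂ _+_ (sifting-image _≟ˢ_ _≟ˢ_ (true ∷_) (λ { refl → refl }) Ls (allSubsets-sifting n) I g)
                   (sifting-miss _≟ˢ_ (false ∷_) (true ∷ I) (λ _ ()) Ls g) ⟩
    g (true ∷ I) + 0ℚ
      ≡⟨ +-identityʳ _ ⟩
    g (true ∷ I) ∎
    where
    open ≡-Reasoning
    Ls : List (Subset n)
    Ls = allSubsets n
  allSubsets-sifting (ℕ.suc n) (false ∷ I) g = begin
    ∑ (map (true ∷_) Ls ++ map (false ∷_) Ls) (pick _≟ˢ_ (false ∷ I) g)
      ≡⟨ ∑-++ (map (true ∷_) Ls) (map (false ∷_) Ls) _ ⟩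
    ∑ (map (true ∷_) Ls) (pick _≟ˢ_ (false ∷ I) g) + ∑ (map (false ∷_) Ls) (pick _≟ˢ_ (false ∷ I) g)
      ≡⟨ cong₂ _+_ (sifting-miss _≟ˢ_ (true ∷_) (false ∷ I) (λ _ ()) Ls g)
                   (sifting-image _≟ˢ_ _≟ˢ_ (false ∷_) (λ { refl → refl }) Ls (allSubsets-sifting n) I g) ⟩
    0ℚ + g (false ∷ I)
      ≡⟨ +-identityˡ _ ⟩
    g (false ∷ I) ∎
    where
    open ≡-Reasoning
    Ls : List (Subset n)
    Ls = allSubsets n

  weight-⁅⁆ : ∀ {n} (x : Fin n → ℚ) u → weight x ⁅ u ⁆ ≡ x u
  weight-⁅⁆ {n} x u = trans (∑-cong (allFin n) pointwise) (allFin-sifting n u x)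
    where
    pointwise : ∀ v → (if lookup ⁅ u ⁆ v then x v else 0ℚ) ≡ pick _≟_ u x v
    pointwise v with u ≟ v | lookup ⁅ u ⁆ v in v∈?
    ... | yes refl | true = refl
    ... | yes refl | false = ⊥-elim (false≢true (trans (sym v∈?) (∈⇒lookup (x∈⁅x⁆ u))))
    ... | no u≢v | true = ⊥-elim (u≢v (sym (x∈⁅y⁆⇒x≡y u (lookup⇒∈ v∈?))))
    ... | no _ | false = refl

  ⁅⁆-independent : ∀ {n} (G : Graph n) u → IsIndependent G ⁅ u ⁆
  ⁅⁆-independent G u v w v∈ w∈ edge
    rewrite x∈⁅y⁆⇒x≡y u v∈ | x∈⁅y⁆⇒x≡y u w∈ = false≢true (trans (sym (irrefl G u)) edge)

  independent? : ∀ {n} (G : Graph n) I → Dec (IsIndependent G I)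
  independent? G I = all? λ u → all? λ w →
    (u ∈? I) →-dec (w ∈? I) →-dec ¬? (adj G u w Bool.≟ true)

module FourierMotzkin where
  open import Data.Bool using (if_then_else_)
  open import Data.Empty using (⊥-elim)
  open import Data.List using (List; []; _∷_; map; _++_; filter; cartesianProductWith)
  open import Data.List.Membership.Propositional using (_∈_; _∉_)
  open import Data.List.Membership.Propositional.Properties
    using (∈-++⁺ˡ; ∈-++⁺ʳ; ∈-++⁻; ∈-map⁺; ∈-map⁻; ∈-filter⁺; ∈-filter⁻;
           ∈-cartesianProductWith⁺; ∈-cartesianProductWith⁻)
  open import Data.List.Relation.Unary.Any using (here; there)
  open import Data.Product using (Σ; _×_; _,_; proj₁; proj₂)
  open import Data.Sum using (_⊎_; inj₁; inj₂)
  open import Data.Rational using (ℚ; 0ℚ; 1ℚ; _+_; _*_; -_; _-_; _≤_; _<_)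
  open import Data.Rational.Properties
  open import Data.Rational.Solver using (module +-*-Solver)
  open import Relation.Binary.Definitions using (DecidableEquality; tri<; tri≈; tri>)
  open import Relation.Binary.PropositionalEquality
  open import Relation.Nullary using (yes; no; does)
  open +-*-Solver using (solve; _:+_; _:*_; _:-_; :-_; _:=_; con)
  open FiniteSums
  open RationalFacts

  module System {V C : Set}
    (_≟V_ : DecidableEquality V) (vs : List V) (vs-sifting : Sifting _≟V_ vs)
    (_≟C_ : DecidableEquality C) (cs : List C) (cs-sifting : Sifting _≟C_ cs)
    (A : C → V → ℚ) (b : C → ℚ) where

    Point : Set
    Point = V → ℚ

    infix 8 _·_
    _·_ : (V → ℚ) → Point → ℚ
    a · x = ∑ vs (λ v → a v * x v)

    Feasible : Point → Set
    Feasible x = ∀ c → A c · x ≤ b c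

    -- A multiplier l : C → ℚ stands for the combined inequality
    -- (∑_c l c · A c) · x ≤ ∑_c l c · b c.
    Multiplier : Set
    Multiplier = C → ℚ

    combine : (C → ℚ) → Multiplier → ℚ
    combine F l = ∑ cs (λ c → l c * F c)

    coef : Multiplier → V → ℚ
    coef l v = combine (λ c → A c v) l

    rhs : Multiplier → ℚ
    rhs = combine b

    Satisfies : Point → Multiplier → Set
    Satisfies x l = coef l · x ≤ rhs l

    Nonneg : Multiplier → Set
    Nonneg l = ∀ c → 0ℚ ≤ l c

    scale : ℚ → Multiplier → Multiplier
    scale s l c = s * l c

    _⊕_ : Multiplier → Multiplier → Multiplier
    (p ⊕ q) c = p c + q c

    combine-scale : ∀ F s l → combine F (scale s l) ≡ s * combine F l
    combine-scale F s l = trans (∑-cong cs (λ c → *-assoc s (l c) (F c))) (∑-* cs s _)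

    combine-⊕ : ∀ F p q → combine F (p ⊕ q) ≡ combine F p + combine F q
    combine-⊕ F p q = trans (∑-cong cs (λ c → *-distribʳ-+ (F c) (p c) (q c))) (∑-+ cs _ _)

    ·-scale : ∀ s l x → coef (scale s l) · x ≡ s * (coef l · x)
    ·-scale s l x = begin
      coef (scale s l) · x              ≡⟨ ∑-cong vs (λ v → cong (_* x v) (combine-scale _ s l)) ⟩
      ∑ vs (λ v → s * coef l v * x v)   ≡⟨ ∑-cong vs (λ v → *-assoc s (coef l v) (x v)) ⟩
      ∑ vs (λ v → s * (coef l v * x v)) ≡⟨ ∑-* vs s _ ⟩
      s * (coef l · x)                  ∎
      where open ≡-Reasoning

    ·-⊕ : ∀ p q x → coef (p ⊕ q) · x ≡ coef p · x + coef q · x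
    ·-⊕ p q x = begin
      coef (p ⊕ q) · x                                ≡⟨ ∑-cong vs (λ v → cong (_* x v) (combine-⊕ _ p q)) ⟩
      ∑ vs (λ v → (coef p v + coef q v) * x v)        ≡⟨ ∑-cong vs (λ v → *-distribʳ-+ (x v) (coef p v) (coef q v)) ⟩
      ∑ vs (λ v → coef p v * x v + coef q v * x v)    ≡⟨ ∑-+ vs _ _ ⟩
      coef p · x + coef q · x                         ∎
      where open ≡-Reasoning

    satisfies-unscale : ∀ {x l} s → 0ℚ < s → Satisfies x (scale s l) → Satisfies x l
    satisfies-unscale {x} {l} s 0<s sat = *-cancelˡ-≤->0 s 0<s
      (subst₂ _≤_ (·-scale s l x) (combine-scale b s l) sat)

    valid : ∀ {l x} → Nonneg l → Feasible x → Satisfies x l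
    valid {l} {x} l≥0 x-feasible = begin
      coef l · x
        ≡⟨ ∑-cong vs (λ v → trans (*-comm _ (x v)) (sym (∑-* cs (x v) _))) ⟩
      ∑ vs (λ v → ∑ cs (λ c → x v * (l c * A c v)))
        ≡⟨ ∑-swap vs cs _ ⟩
      ∑ cs (λ c → ∑ vs (λ v → x v * (l c * A c v)))
        ≡⟨ ∑-cong cs (λ c → trans (∑-cong vs (λ v → regroup (x v) (l c) (A c v))) (∑-* vs (l c) _)) ⟩
      ∑ cs (λ c → l c * A c · x)
        ≤⟨ ∑-mono cs (λ c → *-monoˡ-≤-≥0 (l c) (l≥0 c) (x-feasible c)) ⟩
      rhs l
        ∎
      where
      open ≤-Reasoning
      regroup : ∀ y m a → y * (m * a) ≡ m * (a * y)
      regroup = solve 3 (λ y m a → y :* (m :* a) := m :* (a :* y)) refl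

    -- Properties of multipliers stable under positive scaling and addition;
    -- elimination only ever forms such combinations.
    record Closed (P : Multiplier → Set) : Set where
      field
        scale-closed : ∀ s l → 0ℚ < s → P l → P (scale s l)
        ⊕-closed     : ∀ p q → P p → P q → P (p ⊕ q)
    open Closed

    nonneg-closed : Closed Nonneg
    nonneg-closed = record
      { scale-closed = λ s l 0<s l≥0 c → *-nonneg (<⇒≤ 0<s) (l≥0 c)
      ; ⊕-closed     = λ p q p≥0 q≥0 c → +-nonneg (p≥0 c) (q≥0 c) }

    vanishes-closed : ∀ v → Closed (λ l → coef l v ≡ 0ℚ)
    vanishes-closed v = record
      { scale-closed = λ s l _ l0 → trans (combine-scale _ s l) (trans (cong (s *_) l0) (*-zeroʳ s))
      ; ⊕-closed     = λ p q p0 q0 → trans (combine-⊕ _ p q) (trans (cong₂ _+_ p0 q0) (+-identityʳ 0ℚ)) }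

    _[_≔_] : Point → V → ℚ → Point
    (x [ j ≔ t ]) v = if does (j ≟V v) then t else x v

    update-≢ : ∀ x j t v → j ≢ v → (x [ j ≔ t ]) v ≡ x v
    update-≢ x j t v j≢v with j ≟V v
    ... | yes j≡v = ⊥-elim (j≢v j≡v)
    ... | no _ = refl

    ·-update : ∀ a x j t → a · (x [ j ≔ t ]) ≡ a · x + a j * (t - x j)
    ·-update a x j t = begin
      a · (x [ j ≔ t ])                                                ≡⟨ ∑-cong vs pointwise ⟩
      ∑ vs (λ v → a v * x v + pick _≟V_ j (λ v → a v * (t - x v)) v)   ≡⟨ ∑-+ vs _ _ ⟩
      a · x + ∑ vs (pick _≟V_ j (λ v → a v * (t - x v)))               ≡⟨ cong (a · x +_) (vs-sifting j _) ⟩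
      a · x + a j * (t - x j)                                          ∎
      where
      open ≡-Reasoning
      pointwise : ∀ v → a v * (x [ j ≔ t ]) v ≡ a v * x v + pick _≟V_ j (λ v → a v * (t - x v)) v
      pointwise v with j ≟V v
      ... | yes refl = solve 3 (λ a t y → a :* t := a :* y :+ a :* (t :- y)) refl (a j) t (x j)
      ... | no _ = sym (+-identityʳ _)

    module Eliminate (j : V) where

      cj : Multiplier → ℚ
      cj l = coef l j

      rest : Point → Multiplier → ℚ
      rest x l = coef l · x - cj l * x j

      lhs-update : ∀ x t l → coef l · (x [ j ≔ t ]) ≡ cj l * t + rest x l
      lhs-update x t l = trans (·-update (coef l) x j t)
        (solve 4 (λ d c t y → d :+ c :* (t :- y) := c :* t :+ (d :- c :* y)) refl (coef l · x) (cj l) t (x j))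

      lhs-split : ∀ x l → coef l · x ≡ cj l * x j + rest x l
      lhs-split x l = solve 2 (λ d e → d := e :+ (d :- e)) refl (coef l · x) (cj l * x j)

      Level Uppers Lowers : List Multiplier → List Multiplier
      Level L = filter (λ l → cj l ≟ 0ℚ) L
      Uppers L = map (λ l → scale (inv (cj l)) l) (filter (λ l → 0ℚ <? cj l) L)
      Lowers L = map (λ l → scale (inv (- cj l)) l) (filter (λ l → cj l <? 0ℚ) L)

      eliminate : List Multiplier → List Multiplier
      eliminate L = Level L ++ cartesianProductWith _⊕_ (Uppers L) (Lowers L)

      Rescales : List Multiplier → Multiplier → Set
      Rescales L d = Σ Multiplier λ l → Σ ℚ λ s → l ∈ L × 0ℚ < s × d ≡ scale s l

      rescales-closed : ∀ {P L d} → Closed P → (∀ l → l ∈ L → P l) → Rescales L d → P d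
      rescales-closed cl P-L (l , s , l∈L , 0<s , refl) = scale-closed cl s l 0<s (P-L l l∈L)

      ∈-Uppers : ∀ L d → d ∈ Uppers L → Rescales L d × cj d ≡ 1ℚ
      ∈-Uppers L d d∈ with ∈-map⁻ _ d∈
      ... | l , l∈ , refl with ∈-filter⁻ (λ l → 0ℚ <? cj l) l∈
      ...   | l∈L , 0<cj = (l , inv (cj l) , l∈L , inv-positive _ 0<cj , refl) ,
        trans (combine-scale (λ c → A c j) (inv (cj l)) l) (inv-cancel (cj l) (λ cj≡0 → <-irrefl (sym cj≡0) 0<cj))

      ∈-Lowers : ∀ L d → d ∈ Lowers L → Rescales L d × cj d ≡ - 1ℚ
      ∈-Lowers L d d∈ with ∈-map⁻ _ d∈
      ... | l , l∈ , refl with ∈-filter⁻ (λ l → cj l <? 0ℚ) l∈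
      ...   | l∈L , cj<0 = (l , inv (- cj l) , l∈L , inv-positive _ 0<-cj , refl) , normalised
        where
        0<-cj : 0ℚ < - cj l
        0<-cj = neg-antimono-< cj<0
        normalised : cj (scale (inv (- cj l)) l) ≡ - 1ℚ
        normalised = begin
          cj (scale (inv (- cj l)) l)   ≡⟨ combine-scale (λ c → A c j) (inv (- cj l)) l ⟩
          inv (- cj l) * cj l           ≡⟨ solve 2 (λ i c → i :* c := :- (i :* (:- c))) refl (inv (- cj l)) (cj l) ⟩
          - (inv (- cj l) * - cj l)     ≡⟨ cong -_ (inv-cancel (- cj l) (λ e → <-irrefl (sym e) 0<-cj)) ⟩
          - 1ℚ                          ∎
          where open ≡-Reasoning

      data Position (L : List Multiplier) (l : Multiplier) : Set where
        level : cj l ≡ 0ℚ → l ∈ Level L → Position L l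
        upper : 0ℚ < cj l → ∀ s → 0ℚ < s → scale s l ∈ Uppers L → Position L l
        lower : cj l < 0ℚ → ∀ s → 0ℚ < s → scale s l ∈ Lowers L → Position L l

      position : ∀ {L l} → l ∈ L → Position L l
      position {L} {l} l∈L with <-cmp 0ℚ (cj l)
      ... | tri< 0<cj _ _ = upper 0<cj _ (inv-positive _ 0<cj) (∈-map⁺ _ (∈-filter⁺ (λ l → 0ℚ <? cj l) l∈L 0<cj))
      ... | tri≈ _ 0≡cj _ = level (sym 0≡cj) (∈-filter⁺ (λ l → cj l ≟ 0ℚ) l∈L (sym 0≡cj))
      ... | tri> _ _ cj<0 = lower cj<0 _ (inv-positive _ (neg-antimono-< cj<0)) (∈-map⁺ _ (∈-filter⁺ (λ l → cj l <? 0ℚ) l∈L cj<0))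

      ∈-eliminate⁻ : ∀ L d → d ∈ eliminate L →
        (d ∈ Level L) ⊎ (Σ Multiplier λ p → Σ Multiplier λ q → p ∈ Uppers L × q ∈ Lowers L × d ≡ p ⊕ q)
      ∈-eliminate⁻ L d d∈ with ∈-++⁻ (Level L) d∈
      ... | inj₁ d∈Level = inj₁ d∈Level
      ... | inj₂ d∈pairs = inj₂ (∈-cartesianProductWith⁻ _⊕_ (Uppers L) (Lowers L) d∈pairs)

      eliminate-closed : ∀ {P} → Closed P → ∀ L → (∀ l → l ∈ L → P l) → ∀ d → d ∈ eliminate L → P d
      eliminate-closed cl L P-L d d∈ with ∈-eliminate⁻ L d d∈
      ... | inj₁ d∈Level = P-L d (proj₁ (∈-filter⁻ (λ l → cj l ≟ 0ℚ) {xs = L} d∈Level))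
      ... | inj₂ (p , q , p∈ , q∈ , refl) = ⊕-closed cl p q
        (rescales-closed cl P-L (proj₁ (∈-Uppers L p p∈)))
        (rescales-closed cl P-L (proj₁ (∈-Lowers L q q∈)))

      eliminate-removes : ∀ L d → d ∈ eliminate L → cj d ≡ 0ℚ
      eliminate-removes L d d∈ with ∈-eliminate⁻ L d d∈
      ... | inj₁ d∈Level = proj₂ (∈-filter⁻ (λ l → cj l ≟ 0ℚ) {xs = L} d∈Level)
      ... | inj₂ (p , q , p∈ , q∈ , refl) = begin
        cj (p ⊕ q)   ≡⟨ combine-⊕ (λ c → A c j) p q ⟩
        cj p + cj q  ≡⟨ cong₂ _+_ (proj₂ (∈-Uppers L p p∈)) (proj₂ (∈-Lowers L q q∈)) ⟩
        1ℚ + - 1ℚ    ≡⟨ +-inverseʳ 1ℚ ⟩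
        0ℚ           ∎
        where open ≡-Reasoning

      -- Completeness: any point satisfying the eliminated system can be
      -- corrected in coordinate j so as to satisfy the original one.
      module Complete (x : Point) (L : List Multiplier)
                      (x-sat : ∀ d → d ∈ eliminate L → Satisfies x d) where

        upperBound lowerBound : Multiplier → ℚ
        upperBound p = rhs p - rest x p
        lowerBound q = rest x q - rhs q

        -- Each upper bound on x j dominates each lower bound, because the sum of
        -- the two inequalities belongs to the eliminated system.
        bounds-compatible : ∀ {q p} → q ∈ Lowers L → p ∈ Uppers L → lowerBound q ≤ upperBound p
        bounds-compatible {q} {p} q∈ p∈ = +≤+⇒-≤- {rest x p} {rest x q} {rhs p} {rhs q} (subst₂ _≤_ lhs≡ (combine-⊕ b p q) sum-sat)
          where
          sum-sat : Satisfies x (p ⊕ q)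
          sum-sat = x-sat (p ⊕ q) (∈-++⁺ʳ (Level L) (∈-cartesianProductWith⁺ _⊕_ p∈ q∈))
          lhs≡ : coef (p ⊕ q) · x ≡ rest x p + rest x q
          lhs≡ = begin
            coef (p ⊕ q) · x                                      ≡⟨ ·-⊕ p q x ⟩
            coef p · x + coef q · x                               ≡⟨ cong₂ _+_ (lhs-split x p) (lhs-split x q) ⟩
            cj p * x j + rest x p + (cj q * x j + rest x q)       ≡⟨ cong₂ (λ a c → a * x j + rest x p + (c * x j + rest x q))
                                                                       (proj₂ (∈-Uppers L p p∈)) (proj₂ (∈-Lowers L q q∈)) ⟩
            1ℚ * x j + rest x p + (- 1ℚ * x j + rest x q)         ≡⟨ solve 3 (λ y e f → con 1ℚ :* y :+ e :+ ((:- con 1ℚ) :* y :+ f) := e :+ f)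
                                                                       refl (x j) (rest x p) (rest x q) ⟩
            rest x p + rest x q                                   ∎
            where open ≡-Reasoning

        interval : Σ ℚ λ t → (∀ {q} → q ∈ Lowers L → lowerBound q ≤ t) × (∀ {p} → p ∈ Uppers L → t ≤ upperBound p)
        interval = interpolate lowerBound upperBound (Lowers L) (Uppers L) bounds-compatible

        t : ℚ
        t = proj₁ interval

        above-lower : ∀ {q} → q ∈ Lowers L → lowerBound q ≤ t
        above-lower = proj₁ (proj₂ interval)

        below-upper : ∀ {p} → p ∈ Uppers L → t ≤ upperBound p
        below-upper = proj₂ (proj₂ interval)

        corrected : Point
        corrected = x [ j ≔ t ]

        corrected-elsewhere : ∀ v → j ≢ v → corrected v ≡ x v
        corrected-elsewhere = update-≢ x j t

        satisfied-level : ∀ l → cj l ≡ 0ℚ → l ∈ Level L → Satisfies corrected l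
        satisfied-level l cj≡0 l∈ = subst (_≤ rhs l) (sym moved) (x-sat l (∈-++⁺ˡ l∈))
          where
          moved : coef l · corrected ≡ coef l · x
          moved = begin
            coef l · corrected              ≡⟨ ·-update (coef l) x j t ⟩
            coef l · x + cj l * (t - x j)   ≡⟨ cong (λ c → coef l · x + c * (t - x j)) cj≡0 ⟩
            coef l · x + 0ℚ * (t - x j)     ≡⟨ cong (coef l · x +_) (*-zeroˡ (t - x j)) ⟩
            coef l · x + 0ℚ                 ≡⟨ +-identityʳ (coef l · x) ⟩
            coef l · x                      ∎
            where open ≡-Reasoning

        satisfied-upper : ∀ p → p ∈ Uppers L → Satisfies corrected p
        satisfied-upper p p∈ = subst (_≤ rhs p) (sym lhs≡) (≤-‿⇒+≤ {t} {rest x p} {rhs p} (below-upper p∈))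
          where
          lhs≡ : coef p · corrected ≡ t + rest x p
          lhs≡ = trans (lhs-update x t p)
            (cong (_+ rest x p) (trans (cong (_* t) (proj₂ (∈-Uppers L p p∈))) (*-identityˡ t)))

        satisfied-lower : ∀ q → q ∈ Lowers L → Satisfies corrected q
        satisfied-lower q q∈ = subst (_≤ rhs q) (sym lhs≡) (-≤⇒-+≤ {t} {rest x q} {rhs q} (above-lower q∈))
          where
          lhs≡ : coef q · corrected ≡ - t + rest x q
          lhs≡ = trans (lhs-update x t q)
            (cong (_+ rest x q) (trans (cong (_* t) (proj₂ (∈-Lowers L q q∈)))
              (solve 1 (λ t → (:- con 1ℚ) :* t := :- t) refl t)))

        satisfied-at : ∀ {l} → Position L l → Satisfies corrected l
        satisfied-at {l} (level cj≡0 l∈Level) = satisfied-level l cj≡0 l∈Level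
        satisfied-at {l} (upper _ s 0<s sl∈) = satisfies-unscale s 0<s (satisfied-upper (scale s l) sl∈)
        satisfied-at {l} (lower _ s 0<s sl∈) = satisfies-unscale s 0<s (satisfied-lower (scale s l) sl∈)

        corrected-satisfies : ∀ l → l ∈ L → Satisfies corrected l
        corrected-satisfies l l∈ = satisfied-at (position l∈)

    eliminateAll : List V → List Multiplier → List Multiplier
    eliminateAll [] L = L
    eliminateAll (j ∷ js) L = eliminateAll js (Eliminate.eliminate j L)

    eliminateAll-closed : ∀ {P} → Closed P → ∀ js L → (∀ l → l ∈ L → P l) → ∀ d → d ∈ eliminateAll js L → P d
    eliminateAll-closed cl [] L P-L = P-L
    eliminateAll-closed cl (j ∷ js) L P-L = eliminateAll-closed cl js _ (Eliminate.eliminate-closed j cl L P-L)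

    eliminateAll-removes : ∀ js L {v} → v ∈ js → ∀ d → d ∈ eliminateAll js L → coef d v ≡ 0ℚ
    eliminateAll-removes (j ∷ js) L (here refl) =
      eliminateAll-closed (vanishes-closed j) js _ (Eliminate.eliminate-removes j L)
    eliminateAll-removes (j ∷ js) L (there v∈js) = eliminateAll-removes js _ v∈js

    eliminateAll-complete : ∀ t₀ js → t₀ ∉ js → ∀ L x → (∀ d → d ∈ eliminateAll js L → Satisfies x d) →
      Σ Point λ x′ → (∀ l → l ∈ L → Satisfies x′ l) × x′ t₀ ≡ x t₀
    eliminateAll-complete t₀ [] _ L x x-sat = x , x-sat , refl
    eliminateAll-complete t₀ (j ∷ js) t₀∉ L x x-sat =
      corrected , corrected-satisfies , trans (corrected-elsewhere t₀ (λ j≡t₀ → t₀∉ (here (sym j≡t₀)))) x₁-t₀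
      where
      lifted : Σ Point λ x₁ → (∀ d → d ∈ Eliminate.eliminate j L → Satisfies x₁ d) × x₁ t₀ ≡ x t₀
      lifted = eliminateAll-complete t₀ js (λ t₀∈ → t₀∉ (there t₀∈)) (Eliminate.eliminate j L) x x-sat
      x₁-t₀ : proj₁ lifted t₀ ≡ x t₀
      x₁-t₀ = proj₂ (proj₂ lifted)
      open Eliminate.Complete j (proj₁ lifted) L (proj₁ (proj₂ lifted))

    unit : C → Multiplier
    unit c = pick _≟C_ c (λ _ → 1ℚ)

    combine-unit : ∀ F c → combine F (unit c) ≡ F c
    combine-unit F c = trans (∑-cong cs pointwise) (cs-sifting c F)
      where
      pointwise : ∀ c′ → unit c c′ * F c′ ≡ pick _≟C_ c F c′
      pointwise c′ with c ≟C c′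
      ... | yes refl = *-identityˡ (F c)
      ... | no _ = *-zeroˡ (F c′)

    unit-nonneg : ∀ c → Nonneg (unit c)
    unit-nonneg c c′ with c ≟C c′
    ... | yes _ = 0≤1
    ... | no _ = ≤-refl

    units-nonneg : ∀ l → l ∈ map unit cs → Nonneg l
    units-nonneg l l∈ with ∈-map⁻ unit l∈
    ... | c , _ , refl = unit-nonneg c

    units-feasible : ∀ x → (∀ l → l ∈ map unit cs → Satisfies x l) → Feasible x
    units-feasible x x-sat c = subst₂ _≤_
      (∑-cong vs (λ v → cong (_* x v) (combine-unit (λ c → A c v) c))) (combine-unit b c)
      (x-sat (unit c) (∈-map⁺ unit (sifting-complete _≟C_ cs-sifting c)))

    record DualPair (t₀ : V) : Set where
      field
        multiplier        : Multiplier
        multiplier-nonneg : Nonneg multiplier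
        coef-t₀           : coef multiplier t₀ ≡ 1ℚ
        coef-others       : ∀ v → t₀ ≢ v → coef multiplier v ≡ 0ℚ
        optimum           : Point
        optimum-feasible  : Feasible optimum
        optimum-value     : optimum t₀ ≡ rhs multiplier

    -- If the system is feasible and x t₀ is bounded on it, a DualPair exists:
    -- eliminate every other variable; the remaining upper bounds on x t₀ are
    -- nonempty (else x t₀ would be unbounded) and the least one is attained.
    module Maximise (t₀ : V) (others : List V) (t₀∉others : t₀ ∉ others)
      (others-complete : ∀ v → t₀ ≢ v → v ∈ others)
      (x₀ : Point) (x₀-feasible : Feasible x₀) (K : ℚ) (bounded : ∀ x → Feasible x → x t₀ ≤ K) where

      open Eliminate t₀ using (Uppers; ∈-Uppers; position; level; upper; lower; rescales-closed)

      residual : List Multiplier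
      residual = eliminateAll others (map unit cs)

      OnlyT₀ : Multiplier → Set
      OnlyT₀ d = ∀ v → t₀ ≢ v → coef d v ≡ 0ℚ

      onlyT₀-closed : Closed OnlyT₀
      onlyT₀-closed = record
        { scale-closed = λ s l 0<s l-only v t₀≢v → scale-closed (vanishes-closed v) s l 0<s (l-only v t₀≢v)
        ; ⊕-closed     = λ p q p-only q-only v t₀≢v → ⊕-closed (vanishes-closed v) p q (p-only v t₀≢v) (q-only v t₀≢v) }

      onlyT₀-lhs : ∀ d → OnlyT₀ d → ∀ y → coef d · y ≡ coef d t₀ * y t₀
      onlyT₀-lhs d d-only y = trans (∑-cong vs pointwise) (vs-sifting t₀ (λ v → coef d v * y v))
        where
        pointwise : ∀ v → coef d v * y v ≡ pick _≟V_ t₀ (λ v → coef d v * y v) v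
        pointwise v with t₀ ≟V v
        ... | yes refl = refl
        ... | no t₀≢v = trans (cong (_* y v) (d-only v t₀≢v)) (*-zeroˡ (y v))

      residual-nonneg : ∀ d → d ∈ residual → Nonneg d
      residual-nonneg = eliminateAll-closed nonneg-closed others _ units-nonneg

      residual-onlyT₀ : ∀ d → d ∈ residual → OnlyT₀ d
      residual-onlyT₀ d d∈ v t₀≢v = eliminateAll-removes others _ (others-complete v t₀≢v) d d∈

      residual-at-x₀ : ∀ d → d ∈ residual → coef d t₀ * x₀ t₀ ≤ rhs d
      residual-at-x₀ d d∈ = subst (_≤ rhs d) (onlyT₀-lhs d (residual-onlyT₀ d d∈) x₀)
        (valid (residual-nonneg d d∈) x₀-feasible)

      module _ (T : ℚ) (x₀≤T : x₀ t₀ ≤ T) (T≤uppers : ∀ p → p ∈ Uppers residual → T ≤ rhs p) where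

        residual-sat-at : ∀ {d} → d ∈ residual → Eliminate.Position t₀ residual d → Satisfies (λ _ → T) d
        residual-sat-at {d} d∈ (level cj≡0 _) =
          subst (_≤ rhs d) (sym lhs≡0) (subst (_≤ rhs d) at-x₀≡0 (residual-at-x₀ d d∈))
          where
          lhs≡0 : coef d · (λ _ → T) ≡ 0ℚ
          lhs≡0 = trans (onlyT₀-lhs d (residual-onlyT₀ d d∈) _) (trans (cong (_* T) cj≡0) (*-zeroˡ T))
          at-x₀≡0 : coef d t₀ * x₀ t₀ ≡ 0ℚ
          at-x₀≡0 = trans (cong (_* x₀ t₀) cj≡0) (*-zeroˡ (x₀ t₀))
        residual-sat-at {d} d∈ (upper _ s 0<s sd∈) = satisfies-unscale s 0<s
          (subst (_≤ rhs (scale s d)) (sym lhs≡T) (T≤uppers (scale s d) sd∈))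
          where
          lhs≡T : coef (scale s d) · (λ _ → T) ≡ T
          lhs≡T = trans (onlyT₀-lhs (scale s d) (scale-closed onlyT₀-closed s d 0<s (residual-onlyT₀ d d∈)) _)
                        (trans (cong (_* T) (proj₂ (∈-Uppers residual (scale s d) sd∈))) (*-identityˡ T))
        residual-sat-at {d} d∈ (lower cj<0 _ _ _) = subst (_≤ rhs d) (sym (onlyT₀-lhs d (residual-onlyT₀ d d∈) _))
          (≤-trans (*-monoˡ-≤-≤0 (coef d t₀) (<⇒≤ cj<0) x₀≤T) (residual-at-x₀ d d∈))

        attainable : Σ Point λ x → Feasible x × x t₀ ≡ T
        attainable = proj₁ lifted , units-feasible (proj₁ lifted) (proj₁ (proj₂ lifted)) , proj₂ (proj₂ lifted)
          where
          lifted : Σ Point λ x → (∀ l → l ∈ map unit cs → Satisfies x l) × x t₀ ≡ T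
          lifted = eliminateAll-complete t₀ others t₀∉others (map unit cs) (λ _ → T)
                     (λ d d∈ → residual-sat-at d∈ (position d∈))

      -- Without upper bounds, K + 1 would be attained; otherwise the least upper
      -- bound is attained and is the required multiplier.
      dualPairFrom : ∀ Us → Uppers residual ≡ Us → DualPair t₀
      dualPairFrom [] uppers≡ = ⊥-elim (<-irrefl refl (<-≤-trans K<K+1 K+1≤K))
        where
        K<K+1 : K < K + 1ℚ
        K<K+1 = subst (_< K + 1ℚ) (+-identityʳ K) (+-monoʳ-< K (positive⁻¹ 1ℚ))
        no-uppers : ∀ p → p ∈ Uppers residual → K + 1ℚ ≤ rhs p
        no-uppers p p∈ with () ← subst (p ∈_) uppers≡ p∈
        unbounded : Σ Point λ x → Feasible x × x t₀ ≡ K + 1ℚ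
        unbounded = attainable (K + 1ℚ) (≤-trans (bounded x₀ x₀-feasible) (<⇒≤ K<K+1)) no-uppers
        K+1≤K : K + 1ℚ ≤ K
        K+1≤K = subst (_≤ K) (proj₂ (proj₂ unbounded)) (bounded (proj₁ unbounded) (proj₁ (proj₂ unbounded)))
      dualPairFrom (p₀ ∷ ps) uppers≡ = record
        { multiplier        = m
        ; multiplier-nonneg = rescales-closed nonneg-closed residual-nonneg m-rescales
        ; coef-t₀           = m-coef
        ; coef-others       = m-only
        ; optimum           = proj₁ optimum
        ; optimum-feasible  = proj₁ (proj₂ optimum)
        ; optimum-value     = proj₂ (proj₂ optimum) }
        where
        least : Σ Multiplier λ m → m ∈ (p₀ ∷ ps) × (∀ {p} → p ∈ (p₀ ∷ ps) → rhs m ≤ rhs p)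
        least = minimiser rhs p₀ ps
        m : Multiplier
        m = proj₁ least
        m∈ : m ∈ Uppers residual
        m∈ = subst (m ∈_) (sym uppers≡) (proj₁ (proj₂ least))
        m-rescales : Eliminate.Rescales t₀ residual m
        m-rescales = proj₁ (∈-Uppers residual m m∈)
        m-coef : coef m t₀ ≡ 1ℚ
        m-coef = proj₂ (∈-Uppers residual m m∈)
        m-only : OnlyT₀ m
        m-only = rescales-closed onlyT₀-closed residual-onlyT₀ m-rescales
        x₀≤rhs : x₀ t₀ ≤ rhs m
        x₀≤rhs = subst (_≤ rhs m)
          (trans (onlyT₀-lhs m m-only x₀) (trans (cong (_* x₀ t₀) m-coef) (*-identityˡ (x₀ t₀))))
          (valid (rescales-closed nonneg-closed residual-nonneg m-rescales) x₀-feasible)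
        optimum : Σ Point λ x → Feasible x × x t₀ ≡ rhs m
        optimum = attainable (rhs m) x₀≤rhs (λ p p∈ → proj₂ (proj₂ least) (subst (p ∈_) uppers≡ p∈))

      dualPair : DualPair t₀
      dualPair = dualPairFrom (Uppers residual) refl

module FractionalClique where
  open import Data.Bool using (Bool; true; false; if_then_else_; _∧_)
  open import Data.Empty using (⊥-elim)
  open import Data.Fin using (Fin; zero; suc; _≟_)
  open import Data.Fin.Subset using (Subset; _∈_; _⊆_; ⁅_⁆)
  open import Data.Fin.Subset.Properties using (_⊆?_; x∈⁅y⁆⇒x≡y)
  open import Data.List using (List; _∷_; map; _++_; allFin)
  import Data.List.Membership.Propositional as List
  open import Data.List.Membership.Propositional.Properties using (∈-map⁺; ∈-map⁻; ∈-allFin)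
  open import Data.Nat using (ℕ)
  open import Data.Vec using (lookup)
  open import Data.Product using (_×_; _,_)
  open import Data.Rational using (ℚ; 0ℚ; 1ℚ; _+_; _*_; -_; _-_; _≤_)
  open import Data.Rational.Properties hiding (_≟_)
  open import Data.Rational.Solver using (module +-*-Solver)
  open import Function using (_∘_)
  open import Relation.Binary.Definitions using (DecidableEquality)
  open import Relation.Binary.PropositionalEquality
  open import Relation.Nullary using (Dec; yes; no; does; ¬_)
  open import Relation.Nullary.Decidable using (_×-dec_; dec-true; dec-false)
  open +-*-Solver using (solve; _:+_; _:*_; _:-_; :-_; _:=_; con)
  open import Defs using (Graph; IsIndependent; weight; allSubsets; FracCliqueFeasible; FracColFeasible;
    IsFracCliqueNumber; IsFracChromaticNumber)
  open FiniteSums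
  open RationalFacts
  open SubsetFacts
  open FourierMotzkin

  module _ {n : ℕ} (G : Graph n) (W : Subset n) where

    ColourClass : Subset n → Set
    ColourClass I = I ⊆ W × IsIndependent G I

    colourClass? : ∀ I → Dec (ColourClass I)
    colourClass? I = (I ⊆? W) ×-dec independent? G I

    isColourClass : Subset n → Bool
    isColourClass I = does (colourClass? I)

    cover : (Subset n → ℚ) → Fin n → ℚ
    cover y u = ∑ (allSubsets n) (λ I → if lookup I u then y I else 0ℚ)

    weak-duality : ∀ {x y} → FracCliqueFeasible G W x → FracColFeasible G W y →
      weight x W ≤ ∑ (allSubsets n) y
    weak-duality {x} {y} (x≥0 , x-packing) (y≥0 , y-classes , y-covers) = begin
      weight x W
        ≤⟨ ∑-mono (allFin n) (λ u → scaled u (lookup W u) refl) ⟩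
      ∑ (allFin n) (λ u → if lookup W u then x u * cover y u else 0ℚ)
        ≡⟨ ∑-cong (allFin n) (λ u → expand u (lookup W u)) ⟩
      ∑ (allFin n) (λ u → ∑ Ls (λ I → F I u))
        ≡⟨ ∑-swap (allFin n) Ls F′ ⟩
      ∑ Ls (λ I → ∑ (allFin n) (F I))
        ≤⟨ ∑-mono Ls (λ I → class-bound I (colourClass? I)) ⟩
      ∑ Ls y ∎
      where
      open ≤-Reasoning
      Ls : List (Subset n)
      Ls = allSubsets n

      F : Subset n → Fin n → ℚ
      F I u = if lookup W u then x u * (if lookup I u then y I else 0ℚ) else 0ℚ
      F′ : Fin n → Subset n → ℚ
      F′ u I = F I u

      scaled : ∀ u k → lookup W u ≡ k → (if k then x u else 0ℚ) ≤ (if k then x u * cover y u else 0ℚ)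
      scaled u true u∈W = subst (_≤ x u * cover y u) (*-identityʳ (x u))
        (*-monoˡ-≤-≥0 (x u) (x≥0 u (lookup⇒∈ u∈W)) (y-covers u (lookup⇒∈ u∈W)))
      scaled u false _ = ≤-refl

      expand : ∀ u k → (if k then x u * cover y u else 0ℚ) ≡
                       ∑ Ls (λ I → if k then x u * (if lookup I u then y I else 0ℚ) else 0ℚ)
      expand u true = sym (∑-* Ls (x u) _)
      expand u false = sym (∑-zero Ls)

      class-bound : ∀ I → Dec (ColourClass I) → ∑ (allFin n) (F I) ≤ y I
      class-bound I (yes (I⊆W , I-independent)) = begin
        ∑ (allFin n) (F I)                                          ≡⟨ ∑-cong (allFin n) (λ u → in-class u (lookup W u) (lookup I u) refl refl) ⟩
        ∑ (allFin n) (λ u → y I * (if lookup I u then x u else 0ℚ)) ≡⟨ ∑-* (allFin n) (y I) _ ⟩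
        y I * weight x I                                            ≤⟨ *-monoˡ-≤-≥0 (y I) (y≥0 I) (x-packing I I⊆W I-independent) ⟩
        y I * 1ℚ                                                    ≡⟨ *-identityʳ (y I) ⟩
        y I                                                         ∎
        where
        in-class : ∀ u kW kI → lookup W u ≡ kW → lookup I u ≡ kI →
          (if kW then x u * (if kI then y I else 0ℚ) else 0ℚ) ≡ y I * (if kI then x u else 0ℚ)
        in-class u true  true  _ _ = *-comm (x u) (y I)
        in-class u true  false _ _ = trans (*-zeroʳ (x u)) (sym (*-zeroʳ (y I)))
        in-class u false true  u∉W u∈I with () ← trans (sym u∉W) (∈⇒lookup (I⊆W (lookup⇒∈ u∈I)))
        in-class u false false _ _ = sym (*-zeroʳ (y I))
      class-bound I (no not-class) = subst (∑ (allFin n) (F I) ≤_) (sym (y-classes I not-class))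
        (≤-reflexive (trans (∑-cong (allFin n) (λ u → unused u (lookup W u) (lookup I u))) (∑-zero (allFin n))))
        where
        unused : ∀ u kW kI → (if kW then x u * (if kI then y I else 0ℚ) else 0ℚ) ≡ 0ℚ
        unused u true  true  = trans (cong (x u *_) (y-classes I not-class)) (*-zeroʳ (x u))
        unused u true  false = *-zeroʳ (x u)
        unused u false _     = refl

    record EqualWeights : Set where
      field
        value              : ℚ
        clique             : Fin n → ℚ
        clique-feasible    : FracCliqueFeasible G W clique
        clique-weight      : weight clique W ≡ value
        colouring          : Subset n → ℚ
        colouring-feasible : FracColFeasible G W colouring
        colouring-weight   : ∑ (allSubsets n) colouring ≡ value

    module _ (eq : EqualWeights) where
      open EqualWeights eq

      is-fractional-clique-number : IsFracCliqueNumber G W value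
      is-fractional-clique-number =
        (clique , clique-feasible , clique-weight) ,
        λ x x-feasible → subst (weight x W ≤_) colouring-weight (weak-duality x-feasible colouring-feasible)

      is-fractional-chromatic-number : IsFracChromaticNumber G W value
      is-fractional-chromatic-number =
        (colouring , colouring-feasible , colouring-weight) ,
        λ y y-feasible → subst (_≤ ∑ (allSubsets n) y) clique-weight (weak-duality clique-feasible y-feasible)

    -- The fractional clique LP, with the objective as an extra variable τ:
    -- maximise τ subject to  τ ≤ weight x W,  x ≥ 0,  weight x I ≤ 1 for colour classes I.
    -- Variable zero is τ and variable suc u is x u.
    data Constraint : Set where
      objective : Constraint
      nonneg    : Fin n → Constraint
      packing   : Subset n → Constraint

    _≟ᶜ_ : DecidableEquality Constraint
    objective ≟ᶜ objective = yes refl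
    objective ≟ᶜ nonneg _  = no λ ()
    objective ≟ᶜ packing _ = no λ ()
    nonneg _  ≟ᶜ objective = no λ ()
    nonneg u  ≟ᶜ nonneg v with u ≟ v
    ... | yes refl = yes refl
    ... | no u≢v   = no λ { refl → u≢v refl }
    nonneg _  ≟ᶜ packing _ = no λ ()
    packing _ ≟ᶜ objective = no λ ()
    packing _ ≟ᶜ nonneg _  = no λ ()
    packing I ≟ᶜ packing J with I ≟ˢ J
    ... | yes refl = yes refl
    ... | no I≢J   = no λ { refl → I≢J refl }

    constraints : List Constraint
    constraints = objective ∷ (map nonneg (allFin n) ++ map packing (allSubsets n))

    ∑-constraints : ∀ f → ∑ constraints f ≡ f objective + (∑ (map nonneg (allFin n)) f + ∑ (map packing (allSubsets n)) f)
    ∑-constraints f = cong (f objective +_) (∑-++ (map nonneg (allFin n)) (map packing (allSubsets n)) f)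

    nonneg-injective : ∀ {u v} → nonneg u ≡ nonneg v → u ≡ v
    nonneg-injective refl = refl

    packing-injective : ∀ {I J} → packing I ≡ packing J → I ≡ J
    packing-injective refl = refl

    constraints-sifting : Sifting _≟ᶜ_ constraints
    constraints-sifting objective g = begin
      ∑ constraints (pick _≟ᶜ_ objective g) ≡⟨ ∑-constraints (pick _≟ᶜ_ objective g) ⟩
      _                                     ≡⟨ cong₂ _+_ (pick-≡ _≟ᶜ_ objective g)
                                                 (cong₂ _+_ (sifting-miss _≟ᶜ_ nonneg objective (λ _ ()) (allFin n) g)
                                                            (sifting-miss _≟ᶜ_ packing objective (λ _ ()) (allSubsets n) g)) ⟩
      g objective + (0ℚ + 0ℚ)               ≡⟨ solve 1 (λ a → a :+ (con 0ℚ :+ con 0ℚ) := a) refl (g objective) ⟩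
      g objective                           ∎
      where open ≡-Reasoning
    constraints-sifting (nonneg u) g = begin
      ∑ constraints (pick _≟ᶜ_ (nonneg u) g) ≡⟨ ∑-constraints (pick _≟ᶜ_ (nonneg u) g) ⟩
      _                                     ≡⟨ cong₂ _+_ (pick-≢ _≟ᶜ_ (nonneg u) g objective (λ ()))
                                                 (cong₂ _+_ (sifting-image _≟_ _≟ᶜ_ nonneg nonneg-injective (allFin n) (allFin-sifting n) u g)
                                                            (sifting-miss _≟ᶜ_ packing (nonneg u) (λ _ ()) (allSubsets n) g)) ⟩
      0ℚ + (g (nonneg u) + 0ℚ)              ≡⟨ solve 1 (λ a → con 0ℚ :+ (a :+ con 0ℚ) := a) refl (g (nonneg u)) ⟩
      g (nonneg u)                          ∎
      where open ≡-Reasoning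
    constraints-sifting (packing I) g = begin
      ∑ constraints (pick _≟ᶜ_ (packing I) g) ≡⟨ ∑-constraints (pick _≟ᶜ_ (packing I) g) ⟩
      _                                      ≡⟨ cong₂ _+_ (pick-≢ _≟ᶜ_ (packing I) g objective (λ ()))
                                                  (cong₂ _+_ (sifting-miss _≟ᶜ_ nonneg (packing I) (λ _ ()) (allFin n) g)
                                                             (sifting-image _≟ˢ_ _≟ᶜ_ packing packing-injective (allSubsets n) (allSubsets-sifting n) I g)) ⟩
      0ℚ + (0ℚ + g (packing I))              ≡⟨ solve 1 (λ a → con 0ℚ :+ (con 0ℚ :+ a) := a) refl (g (packing I)) ⟩
      g (packing I)                          ∎
      where open ≡-Reasoning

    A : Constraint → Fin (ℕ.suc n) → ℚ
    A objective   zero    = 1ℚ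
    A objective   (suc u) = - ⟦ lookup W u ⟧
    A (nonneg v)  zero    = 0ℚ
    A (nonneg v)  (suc u) = - pick _≟_ v (λ _ → 1ℚ) u
    A (packing I) zero    = 0ℚ
    A (packing I) (suc u) = ⟦ isColourClass I ∧ lookup I u ⟧

    b : Constraint → ℚ
    b objective   = 0ℚ
    b (nonneg _)  = 0ℚ
    b (packing I) = ⟦ isColourClass I ⟧

    open System _≟_ (allFin (ℕ.suc n)) (allFin-sifting (ℕ.suc n)) _≟ᶜ_ constraints constraints-sifting A b

    tail : Point → Fin n → ℚ
    tail x u = x (suc u)

    row : ∀ c x → A c · x ≡ A c zero * x zero + ∑ (allFin n) (λ u → A c (suc u) * tail x u)
    row c x = ∑-allFin-suc n (λ v → A c v * x v)

    objective-row : ∀ x → A objective · x ≡ x zero - weight (tail x) W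
    objective-row x = begin
      A objective · x                                                        ≡⟨ row objective x ⟩
      1ℚ * x zero + ∑ (allFin n) (λ u → - ⟦ lookup W u ⟧ * tail x u)         ≡⟨ cong₂ _+_ (*-identityˡ (x zero)) (∑-cong (allFin n) negated) ⟩
      x zero + ∑ (allFin n) (λ u → - (if lookup W u then tail x u else 0ℚ))  ≡⟨ cong (x zero +_) (∑-neg (allFin n) _) ⟩
      x zero - weight (tail x) W                                             ∎
      where
      open ≡-Reasoning
      negated : ∀ u → - ⟦ lookup W u ⟧ * tail x u ≡ - (if lookup W u then tail x u else 0ℚ)
      negated u = trans (sym (neg-distribˡ-* ⟦ lookup W u ⟧ (tail x u))) (cong -_ (⟦⟧-* (lookup W u) (tail x u)))

    nonneg-row : ∀ v x → A (nonneg v) · x ≡ - tail x v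
    nonneg-row v x = begin
      A (nonneg v) · x                                                    ≡⟨ row (nonneg v) x ⟩
      0ℚ * x zero + ∑ (allFin n) (λ u → - pick _≟_ v (λ _ → 1ℚ) u * tail x u) ≡⟨ cong₂ _+_ (*-zeroˡ (x zero)) (∑-cong (allFin n) negated) ⟩
      0ℚ + ∑ (allFin n) (λ u → - pick _≟_ v (tail x) u)                   ≡⟨ +-identityˡ _ ⟩
      ∑ (allFin n) (λ u → - pick _≟_ v (tail x) u)                        ≡⟨ ∑-neg (allFin n) _ ⟩
      - ∑ (allFin n) (pick _≟_ v (tail x))                                ≡⟨ cong -_ (allFin-sifting n v (tail x)) ⟩
      - tail x v                                                          ∎
      where
      open ≡-Reasoning
      negated : ∀ u → - pick _≟_ v (λ _ → 1ℚ) u * tail x u ≡ - pick _≟_ v (tail x) u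
      negated u with v ≟ u
      ... | yes _ = solve 1 (λ a → (:- con 1ℚ) :* a := :- a) refl (tail x u)
      ... | no _  = solve 1 (λ a → (:- con 0ℚ) :* a := :- con 0ℚ) refl (tail x u)

    packing-row : ∀ I x → ColourClass I → A (packing I) · x ≡ weight (tail x) I
    packing-row I x I-class = begin
      A (packing I) · x                                                     ≡⟨ row (packing I) x ⟩
      0ℚ * x zero + ∑ (allFin n) (λ u → ⟦ isColourClass I ∧ lookup I u ⟧ * tail x u)
                                                                            ≡⟨ cong₂ _+_ (*-zeroˡ (x zero)) (∑-cong (allFin n) restricted) ⟩
      0ℚ + weight (tail x) I                                                ≡⟨ +-identityˡ _ ⟩
      weight (tail x) I                                                     ∎
      where
      open ≡-Reasoning
      restricted : ∀ u → ⟦ isColourClass I ∧ lookup I u ⟧ * tail x u ≡ (if lookup I u then tail x u else 0ℚ)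
      restricted u rewrite dec-true (colourClass? I) I-class = ⟦⟧-* (lookup I u) (tail x u)

    packing-bound : ∀ I → ColourClass I → b (packing I) ≡ 1ℚ
    packing-bound I I-class = cong ⟦_⟧ (dec-true (colourClass? I) I-class)

    module _ {x : Point} (x-feasible : Feasible x) where

      objective≤weight : x zero ≤ weight (tail x) W
      objective≤weight = -≤0⇒≤ (subst (_≤ 0ℚ) (objective-row x) (x-feasible objective))

      weights-nonneg : ∀ u → 0ℚ ≤ tail x u
      weights-nonneg u = neg≤0⇒0≤ (subst (_≤ 0ℚ) (nonneg-row u x) (x-feasible (nonneg u)))

      class-weight≤1 : ∀ I → ColourClass I → weight (tail x) I ≤ 1ℚ
      class-weight≤1 I I-class = subst₂ _≤_ (packing-row I x I-class) (packing-bound I I-class) (x-feasible (packing I))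

      tail-clique : FracCliqueFeasible G W (tail x)
      tail-clique = (λ u _ → weights-nonneg u) , (λ I I⊆W I-independent → class-weight≤1 I (I⊆W , I-independent))

      -- Singletons ⁅ u ⁆ ⊆ W are colour classes, so the objective is at most |V|.
      objective-bounded : x zero ≤ ∑ (allFin n) (λ _ → 1ℚ)
      objective-bounded = ≤-trans objective≤weight (∑-mono (allFin n) (λ u → vertex≤1 u (lookup W u) refl))
        where
        vertex≤1 : ∀ u k → lookup W u ≡ k → (if k then tail x u else 0ℚ) ≤ 1ℚ
        vertex≤1 u true u∈W = subst (_≤ 1ℚ) (weight-⁅⁆ (tail x) u) (class-weight≤1 ⁅ u ⁆ (⁅u⁆⊆W , ⁅⁆-independent G u))
          where
          ⁅u⁆⊆W : ⁅ u ⁆ ⊆ W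
          ⁅u⁆⊆W v∈⁅u⁆ rewrite x∈⁅y⁆⇒x≡y u v∈⁅u⁆ = lookup⇒∈ u∈W
        vertex≤1 u false _ = 0≤1

    origin-feasible : Feasible (λ _ → 0ℚ)
    origin-feasible c = subst (_≤ b c) (sym lhs≡0) (b-nonneg c)
      where
      lhs≡0 : A c · (λ _ → 0ℚ) ≡ 0ℚ
      lhs≡0 = ∑-*-zero (allFin (ℕ.suc n)) (A c)
      b-nonneg : ∀ c → 0ℚ ≤ b c
      b-nonneg objective = ≤-refl
      b-nonneg (nonneg _) = ≤-refl
      b-nonneg (packing I) with isColourClass I
      ... | true = 0≤1
      ... | false = ≤-refl

    others : List (Fin (ℕ.suc n))
    others = map suc (allFin n)

    zero∉others : zero List.∉ others
    zero∉others zero∈ with ∈-map⁻ suc zero∈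
    ... | _ , _ , ()

    others-complete : ∀ v → zero ≢ v → v List.∈ others
    others-complete zero zero≢zero = ⊥-elim (zero≢zero refl)
    others-complete (suc u) _ = ∈-map⁺ suc (∈-allFin u)

    -- Kept opaque: only its fields are used, and unfolding the elimination is costly.
    opaque
      dual : DualPair zero
      dual = Maximise.dualPair zero others zero∉others others-complete
               (λ _ → 0ℚ) origin-feasible (∑ (allFin n) (λ _ → 1ℚ)) (λ x x-feasible → objective-bounded x-feasible)

    open DualPair dual

    -- The multipliers of the colour-class constraints form a fractional colouring.
    colouring : Subset n → ℚ
    colouring I = if isColourClass I then multiplier (packing I) else 0ℚ

    combine-split : ∀ F → combine F multiplier ≡ multiplier objective * F objective +
      (∑ (allFin n) (λ v → multiplier (nonneg v) * F (nonneg v)) + ∑ (allSubsets n) (λ I → multiplier (packing I) * F (packing I)))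
    combine-split F = trans (∑-constraints (λ c → multiplier c * F c))
      (cong (multiplier objective * F objective +_)
        (cong₂ _+_ (∑-map (allFin n) nonneg (λ c → multiplier c * F c)) (∑-map (allSubsets n) packing (λ c → multiplier c * F c))))

    -- τ has coefficient 1, and only the objective row mentions τ.
    objective-multiplier : multiplier objective ≡ 1ℚ
    objective-multiplier = trans (sym coef≡) coef-t₀
      where
      coef≡ : coef multiplier zero ≡ multiplier objective
      coef≡ = begin
        coef multiplier zero
          ≡⟨ combine-split (λ c → A c zero) ⟩
        multiplier objective * 1ℚ + (∑ (allFin n) (λ v → multiplier (nonneg v) * 0ℚ) + ∑ (allSubsets n) (λ I → multiplier (packing I) * 0ℚ))
          ≡⟨ cong₂ _+_ (*-identityʳ (multiplier objective))
                       (cong₂ _+_ (∑-*-zero (allFin n) (multiplier ∘ nonneg)) (∑-*-zero (allSubsets n) (multiplier ∘ packing))) ⟩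
        multiplier objective + (0ℚ + 0ℚ)
          ≡⟨ solve 1 (λ a → a :+ (con 0ℚ :+ con 0ℚ) := a) refl (multiplier objective) ⟩
        multiplier objective
          ∎
        where open ≡-Reasoning

    vertex-coef : ∀ u → coef multiplier (suc u) ≡ - ⟦ lookup W u ⟧ + (- multiplier (nonneg u) + cover colouring u)
    vertex-coef u = trans (combine-split (λ c → A c (suc u)))
      (cong₂ _+_ objective-part (cong₂ _+_ nonneg-part packing-part))
      where
      objective-part : multiplier objective * - ⟦ lookup W u ⟧ ≡ - ⟦ lookup W u ⟧
      objective-part = trans (cong (_* - ⟦ lookup W u ⟧) objective-multiplier) (*-identityˡ _)
      nonneg-part : ∑ (allFin n) (λ v → multiplier (nonneg v) * - pick _≟_ v (λ _ → 1ℚ) u) ≡ - multiplier (nonneg u)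
      nonneg-part = begin
        ∑ (allFin n) (λ v → multiplier (nonneg v) * - pick _≟_ v (λ _ → 1ℚ) u)  ≡⟨ ∑-cong (allFin n) selected ⟩
        ∑ (allFin n) (λ v → - pick _≟_ u (multiplier ∘ nonneg) v)               ≡⟨ ∑-neg (allFin n) _ ⟩
        - ∑ (allFin n) (pick _≟_ u (multiplier ∘ nonneg))                       ≡⟨ cong -_ (allFin-sifting n u (multiplier ∘ nonneg)) ⟩
        - multiplier (nonneg u)                                                 ∎
        where
        open ≡-Reasoning
        selected : ∀ v → multiplier (nonneg v) * - pick _≟_ v (λ _ → 1ℚ) u ≡ - pick _≟_ u (multiplier ∘ nonneg) v
        selected v with v ≟ u | u ≟ v
        ... | yes refl | yes _     = solve 1 (λ a → a :* (:- con 1ℚ) := :- a) refl (multiplier (nonneg v))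
        ... | no _     | no _      = solve 1 (λ a → a :* (:- con 0ℚ) := :- con 0ℚ) refl (multiplier (nonneg v))
        ... | yes refl | no u≢u    = ⊥-elim (u≢u refl)
        ... | no v≢u   | yes u≡v   = ⊥-elim (v≢u (sym u≡v))
      packing-part : ∑ (allSubsets n) (λ I → multiplier (packing I) * ⟦ isColourClass I ∧ lookup I u ⟧) ≡ cover colouring u
      packing-part = ∑-cong (allSubsets n) (λ I → in-class I (isColourClass I) (lookup I u))
        where
        in-class : ∀ I k m → multiplier (packing I) * ⟦ k ∧ m ⟧ ≡ (if m then (if k then multiplier (packing I) else 0ℚ) else 0ℚ)
        in-class I true  true  = *-identityʳ (multiplier (packing I))
        in-class I true  false = *-zeroʳ (multiplier (packing I))
        in-class I false true  = *-zeroʳ (multiplier (packing I))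
        in-class I false false = *-zeroʳ (multiplier (packing I))

    -- Since x u has coefficient 0, the colour classes cover u ∈ W with total
    -- weight 1 + (multiplier of x u ≥ 0).
    covering : ∀ u → u ∈ W → 1ℚ ≤ cover colouring u
    covering u u∈W = subst (1ℚ ≤_) (sym cover≡) (≤+nonneg (multiplier-nonneg (nonneg u)))
      where
      a s : ℚ
      a = multiplier (nonneg u)
      s = cover colouring u
      balance : - 1ℚ + (- a + s) ≡ 0ℚ
      balance = begin
        - 1ℚ + (- a + s)                  ≡⟨ cong (λ k → - ⟦ k ⟧ + (- a + s)) (sym (∈⇒lookup u∈W)) ⟩
        - ⟦ lookup W u ⟧ + (- a + s)      ≡⟨ sym (vertex-coef u) ⟩
        coef multiplier (suc u)           ≡⟨ coef-others (suc u) (λ ()) ⟩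
        0ℚ                                ∎
        where open ≡-Reasoning
      cover≡ : s ≡ 1ℚ + a
      cover≡ = begin
        s                                 ≡⟨ solve 2 (λ a s → s := (:- con 1ℚ :+ (:- a :+ s)) :+ (con 1ℚ :+ a)) refl a s ⟩
        - 1ℚ + (- a + s) + (1ℚ + a)       ≡⟨ cong (_+ (1ℚ + a)) balance ⟩
        0ℚ + (1ℚ + a)                     ≡⟨ +-identityˡ (1ℚ + a) ⟩
        1ℚ + a                            ∎
        where open ≡-Reasoning

    colouring-feasible : FracColFeasible G W colouring
    colouring-feasible = nonneg-classes , outside-classes , covering
      where
      nonneg-classes : ∀ I → 0ℚ ≤ colouring I
      nonneg-classes I with isColourClass I
      ... | true = multiplier-nonneg (packing I)
      ... | false = ≤-refl
      outside-classes : ∀ I → ¬ ColourClass I → colouring I ≡ 0ℚ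
      outside-classes I not-class rewrite dec-false (colourClass? I) not-class = refl

    colouring-weight : ∑ (allSubsets n) colouring ≡ optimum zero
    colouring-weight = sym (begin
      optimum zero
        ≡⟨ optimum-value ⟩
      rhs multiplier
        ≡⟨ combine-split b ⟩
      multiplier objective * 0ℚ + (∑ (allFin n) (λ v → multiplier (nonneg v) * 0ℚ) + ∑ (allSubsets n) (λ I → multiplier (packing I) * ⟦ isColourClass I ⟧))
        ≡⟨ cong₂ _+_ (*-zeroʳ (multiplier objective))
                     (cong₂ _+_ (∑-*-zero (allFin n) (multiplier ∘ nonneg)) (∑-cong (allSubsets n) in-class)) ⟩
      0ℚ + (0ℚ + ∑ (allSubsets n) colouring)
        ≡⟨ solve 1 (λ a → con 0ℚ :+ (con 0ℚ :+ a) := a) refl (∑ (allSubsets n) colouring) ⟩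
      ∑ (allSubsets n) colouring
        ∎)
      where
      open ≡-Reasoning
      in-class : ∀ I → multiplier (packing I) * ⟦ isColourClass I ⟧ ≡ colouring I
      in-class I with isColourClass I
      ... | true = *-identityʳ (multiplier (packing I))
      ... | false = *-zeroʳ (multiplier (packing I))

    clique-weight : weight (tail optimum) W ≡ optimum zero
    clique-weight = ≤-antisym
      (subst (weight (tail optimum) W ≤_) colouring-weight (weak-duality (tail-clique optimum-feasible) colouring-feasible))
      (objective≤weight optimum-feasible)

    equal-weights : EqualWeights
    equal-weights = record
      { value              = optimum zero
      ; clique             = tail optimum
      ; clique-feasible    = tail-clique optimum-feasible
      ; clique-weight      = clique-weight
      ; colouring          = colouring
      ; colouring-feasible = colouring-feasible
      ; colouring-weight   = colouring-weight }

module Neighbourhood where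
  open import Data.Bool using (Bool; true; false; if_then_else_; _∧_; _∨_; not)
  open import Data.Bool.Properties using (∨-zeroʳ)
  import Data.Bool as Bool
  open import Data.Empty using (⊥-elim)
  open import Data.Fin using (Fin; _≟_)
  open import Data.Fin.Properties using (any?)
  open import Data.Fin.Subset using (Subset; _∈_; _∉_; _⊆_; ⁅_⁆; ∁)
  open import Data.Fin.Subset.Properties using (_∈?_; x∈⁅x⁆; x∈⁅y⁆⇒x≡y; x∈p⇒x∉∁p; x∉p⇒x∈∁p)
  open import Data.List using (allFin)
  open import Data.Nat using (ℕ)
  open import Data.Product using (∃; _×_; _,_; proj₁; proj₂)
  open import Data.Rational using (ℚ; 0ℚ; 1ℚ; _+_; _≤_)
  open import Data.Rational.Properties hiding (_≟_)
  open import Data.Sum using (inj₁; inj₂)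
  open import Data.Vec using (lookup; tabulate)
  open import Data.Vec.Properties using (lookup∘tabulate)
  open import Relation.Binary.PropositionalEquality
  open import Relation.Nullary using (Dec; yes; no; does; ¬_)
  open import Relation.Nullary.Decidable using (_×-dec_; dec-true; dec-false)
  open import Defs using (Graph; adj; irrefl; Edge; IsVertexCover; IsIndependent; weight; 𝟙; Nbhd;
    IsChosenCover; NuFeasible; IsNu; FracCliqueFeasible) renaming (sym to adj-sym)
  open FiniteSums
  open RationalFacts
  open SubsetFacts
  open FractionalClique using (EqualWeights; equal-weights; is-fractional-clique-number)

  𝟙≡pick : ∀ {n} (v u : Fin n) → 𝟙 v u ≡ pick _≟_ v (λ _ → 1ℚ) u
  𝟙≡pick v u with v ≟ u
  ... | yes _ = refl
  ... | no _ = refl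

  weight-𝟙 : ∀ {n} (v : Fin n) T → weight (𝟙 v) T ≡ ⟦ lookup T v ⟧
  weight-𝟙 {n} v T = trans (∑-cong (allFin n) pointwise) (allFin-sifting n v (λ u → ⟦ lookup T u ⟧))
    where
    pointwise : ∀ u → (if lookup T u then 𝟙 v u else 0ℚ) ≡ pick _≟_ v (λ u → ⟦ lookup T u ⟧) u
    pointwise u rewrite 𝟙≡pick v u with v ≟ u | lookup T u
    ... | yes _ | true  = refl
    ... | yes _ | false = refl
    ... | no _  | true  = refl
    ... | no _  | false = refl

  weight-+ : ∀ {n} (f g : Fin n → ℚ) T → weight (λ u → f u + g u) T ≡ weight f T + weight g T
  weight-+ {n} f g T = trans (∑-cong (allFin n) pointwise) (∑-+ (allFin n) _ _)
    where
    pointwise : ∀ u → (if lookup T u then f u + g u else 0ℚ) ≡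
                      (if lookup T u then f u else 0ℚ) + (if lookup T u then g u else 0ℚ)
    pointwise u with lookup T u
    ... | true = refl
    ... | false = sym (+-identityʳ 0ℚ)

  restrict : ∀ {n} → Subset n → (Fin n → ℚ) → Fin n → ℚ
  restrict W c u = if lookup W u then c u else 0ℚ

  restrict-weight : ∀ {n} {W T : Subset n} (c : Fin n → ℚ) → (∀ u → lookup W u ≡ true → lookup T u ≡ true) →
    weight (restrict W c) T ≡ weight c W
  restrict-weight {n} {W} {T} c W⊆T = ∑-cong (allFin n) pointwise
    where
    pointwise : ∀ u → (if lookup T u then restrict W c u else 0ℚ) ≡ (if lookup W u then c u else 0ℚ)
    pointwise u with lookup W u in W[u]
    ... | true rewrite W⊆T u W[u] = refl
    ... | false with lookup T u
    ...   | true = refl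
    ...   | false = refl

  ∧-not : ∀ {a b} → a ∧ not b ≡ true → a ≡ true × b ≡ false
  ∧-not {true} {false} _ = refl , refl

  module _ {n : ℕ} (G : Graph n) (v : Fin n) (S : Subset n) (S-chosen : IsChosenCover G (𝟙 v) S) where

    N : Subset n
    N = Nbhd G v

    S-cover : IsVertexCover G S
    S-cover = proj₁ S-chosen

    S-cheapest : ∀ T → IsVertexCover G T → weight (𝟙 v) S ≤ weight (𝟙 v) T
    S-cheapest = proj₁ (proj₂ S-chosen)

    N[_] : ∀ u → lookup N u ≡ adj G v u
    N[ u ] = lookup∘tabulate (adj G v) u

    v∉N : lookup N v ≡ false
    v∉N = trans N[ v ] (irrefl G v)

    -- All vertices but v form a cover of cost 0, so the cheapest cover avoids v …
    v∉S : lookup S v ≡ false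
    v∉S with lookup S v in S[v]
    ... | false = refl
    ... | true = ⊥-elim (<-irrefl refl (<-≤-trans (positive⁻¹ 1ℚ) 1≤0))
      where
      others-cover : IsVertexCover G (∁ ⁅ v ⁆)
      others-cover u w edge with u ∈? ⁅ v ⁆
      ... | no u≢v = inj₁ (x∉p⇒x∈∁p u≢v)
      ... | yes u∈⁅v⁆ rewrite x∈⁅y⁆⇒x≡y v u∈⁅v⁆ = inj₂ (x∉p⇒x∈∁p w≢v)
        where
        w≢v : w ∉ ⁅ v ⁆
        w≢v w∈⁅v⁆ = false≢true (trans (sym (irrefl G v)) (subst (λ z → adj G v z ≡ true) (x∈⁅y⁆⇒x≡y v w∈⁅v⁆) edge))
      1≤0 : 1ℚ ≤ 0ℚ
      1≤0 = subst₂ _≤_ (trans (weight-𝟙 v S) (cong ⟦_⟧ S[v]))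
                       (trans (weight-𝟙 v (∁ ⁅ v ⁆)) (cong ⟦_⟧ (∉⇒lookup (x∈p⇒x∉∁p (x∈⁅x⁆ v)))))
                       (S-cheapest (∁ ⁅ v ⁆) others-cover)

    -- … and therefore contains every neighbour of v.
    N⊆S : ∀ u → lookup N u ≡ true → lookup S u ≡ true
    N⊆S u N[u] with S-cover v u (trans (sym N[ u ]) N[u])
    ... | inj₁ v∈S = ⊥-elim (false≢true (trans (sym v∉S) (∈⇒lookup v∈S)))
    ... | inj₂ u∈S = ∈⇒lookup u∈S

    open EqualWeights (equal-weights G N) using (value; clique; clique-feasible; clique-weight)

    -- Lower bound: put weight 1 on v and an optimal fractional clique on N.
    point : Fin n → ℚ
    point u = 𝟙 v u + restrict N clique u

    restricted-nonneg : ∀ u → 0ℚ ≤ restrict N clique u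
    restricted-nonneg u with lookup N u in N[u]
    ... | true = proj₁ clique-feasible u (lookup⇒∈ N[u])
    ... | false = ≤-refl

    weight-point : ∀ T → weight point T ≡ ⟦ lookup T v ⟧ + weight (restrict N clique) T
    weight-point T = trans (weight-+ (𝟙 v) (restrict N clique) T) (cong (_+ weight (restrict N clique) T) (weight-𝟙 v T))

    uncovered : Subset n → Subset n
    uncovered T = tabulate (λ u → lookup N u ∧ not (lookup T u))

    lookup-uncovered : ∀ T u → lookup (uncovered T) u ≡ lookup N u ∧ not (lookup T u)
    lookup-uncovered T u = lookup∘tabulate (λ u → lookup N u ∧ not (lookup T u)) u

    split-clique : ∀ T → weight clique N ≡ weight (restrict N clique) T + weight clique (uncovered T)
    split-clique T = trans (∑-cong (allFin n) pointwise) (∑-+ (allFin n) _ _)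
      where
      pointwise : ∀ u → (if lookup N u then clique u else 0ℚ) ≡
        (if lookup T u then restrict N clique u else 0ℚ) + (if lookup (uncovered T) u then clique u else 0ℚ)
      pointwise u rewrite lookup-uncovered T u with lookup N u | lookup T u
      ... | true  | true  = sym (+-identityʳ (clique u))
      ... | true  | false = sym (+-identityˡ (clique u))
      ... | false | true  = sym (+-identityʳ 0ℚ)
      ... | false | false = sym (+-identityʳ 0ℚ)

    -- For a cover T, the uncovered neighbours are independent, and there are
    -- none at all unless v ∈ T; either way they weigh at most [v ∈ T].
    uncovered-bound : ∀ T → IsVertexCover G T → weight clique (uncovered T) ≤ ⟦ lookup T v ⟧
    uncovered-bound T T-cover with lookup T v in T[v]
    ... | true = proj₂ clique-feasible (uncovered T) uncovered⊆N uncovered-independent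
      where
      uncovered-parts : ∀ {u} → u ∈ uncovered T → lookup N u ≡ true × lookup T u ≡ false
      uncovered-parts {u} u∈ = ∧-not (trans (sym (lookup-uncovered T u)) (∈⇒lookup u∈))
      uncovered⊆N : uncovered T ⊆ N
      uncovered⊆N u∈ = lookup⇒∈ (proj₁ (uncovered-parts u∈))
      uncovered-independent : IsIndependent G (uncovered T)
      uncovered-independent u w u∈ w∈ edge with T-cover u w edge
      ... | inj₁ u∈T = false≢true (trans (sym (proj₂ (uncovered-parts u∈))) (∈⇒lookup u∈T))
      ... | inj₂ w∈T = false≢true (trans (sym (proj₂ (uncovered-parts w∈))) (∈⇒lookup w∈T))
    ... | false = ≤-reflexive (trans (∑-cong (allFin n) nothing-uncovered) (∑-zero (allFin n)))
      where
      nothing-uncovered : ∀ u → (if lookup (uncovered T) u then clique u else 0ℚ) ≡ 0ℚ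
      nothing-uncovered u rewrite lookup-uncovered T u with lookup N u in N[u]
      ... | false = refl
      ... | true with T-cover v u (trans (sym N[ u ]) N[u])
      ...   | inj₁ v∈T = ⊥-elim (false≢true (trans (sym T[v]) (∈⇒lookup v∈T)))
      ...   | inj₂ u∈T rewrite ∈⇒lookup u∈T = refl

    point-feasible : NuFeasible G (𝟙 v) S point
    point-feasible = (λ u → ≤+nonneg (restricted-nonneg u)) , outside-S , cheapest
      where
      outside-S : ∀ u → u ∉ S → point u ≡ 𝟙 v u
      outside-S u u∉S with lookup N u in N[u]
      ... | true = ⊥-elim (u∉S (lookup⇒∈ (N⊆S u N[u])))
      ... | false = +-identityʳ (𝟙 v u)
      cheapest : ∀ T → IsVertexCover G T → weight point S ≤ weight point T
      cheapest T T-cover = begin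
        weight point S                                                       ≡⟨ weight-point S ⟩
        ⟦ lookup S v ⟧ + weight (restrict N clique) S                        ≡⟨ cong₂ _+_ (cong ⟦_⟧ v∉S) (restrict-weight {W = N} {T = S} clique N⊆S) ⟩
        0ℚ + weight clique N                                                 ≡⟨ +-identityˡ _ ⟩
        weight clique N                                                      ≡⟨ split-clique T ⟩
        weight (restrict N clique) T + weight clique (uncovered T)           ≤⟨ +-monoʳ-≤ (weight (restrict N clique) T) (uncovered-bound T T-cover) ⟩
        weight (restrict N clique) T + ⟦ lookup T v ⟧                        ≡⟨ +-comm (weight (restrict N clique) T) ⟦ lookup T v ⟧ ⟩
        ⟦ lookup T v ⟧ + weight (restrict N clique) T                        ≡⟨ sym (weight-point T) ⟩
        weight point T                                                       ∎
        where open ≤-Reasoning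

    point-weight : weight point S ≡ value
    point-weight = begin
      weight point S                                 ≡⟨ weight-point S ⟩
      ⟦ lookup S v ⟧ + weight (restrict N clique) S  ≡⟨ cong₂ _+_ (cong ⟦_⟧ v∉S) (restrict-weight {W = N} {T = S} clique N⊆S) ⟩
      0ℚ + weight clique N                           ≡⟨ +-identityˡ _ ⟩
      weight clique N                                ≡⟨ clique-weight ⟩
      value                                          ∎
      where open ≡-Reasoning

    -- Upper bound: any feasible x of the ν-LP is a fractional clique on N and
    -- weighs S no more than N.
    module _ {x : Fin n → ℚ} (x-feasible : NuFeasible G (𝟙 v) S x) where

      x-outside : ∀ u → lookup S u ≡ false → x u ≡ 𝟙 v u
      x-outside u S[u] = proj₁ (proj₂ x-feasible) u (λ u∈S → false≢true (trans (sym S[u]) (∈⇒lookup u∈S)))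

      v≢S : ∀ u → lookup S u ≡ true → v ≢ u
      v≢S u S[u] refl = false≢true (trans (sym v∉S) S[u])

      -- Exchange argument: for an independent I ⊆ S, the set (S ∖ I) ∪ N(I) is
      -- a vertex cover, and comparing it with S bounds the weight of I.
      module Exchange (I : Subset n) (I⊆S : ∀ u → lookup I u ≡ true → lookup S u ≡ true)
                      (I-independent : IsIndependent G I) where

        Touches : Fin n → Set
        Touches u = ∃ λ w → w ∈ I × Edge G w u

        touches? : ∀ u → Dec (Touches u)
        touches? u = any? (λ w → (w ∈? I) ×-dec (adj G w u Bool.≟ true))

        touches : Fin n → Bool
        touches u = does (touches? u)

        exchanged : Subset n
        exchanged = tabulate (λ u → (lookup S u ∧ not (lookup I u)) ∨ touches u)

        lookup-exchanged : ∀ u → lookup exchanged u ≡ (lookup S u ∧ not (lookup I u)) ∨ touches u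
        lookup-exchanged = lookup∘tabulate (λ u → (lookup S u ∧ not (lookup I u)) ∨ touches u)

        touching⇒exchanged : ∀ {u} → Touches u → u ∈ exchanged
        touching⇒exchanged {u} t = lookup⇒∈ (trans (lookup-exchanged u)
          (trans (cong (_ ∨_) (dec-true (touches? u) t)) (∨-zeroʳ _)))

        exchanged-cover : IsVertexCover G exchanged
        exchanged-cover u w edge with lookup I u in I[u] | lookup I w in I[w]
        ... | true | _ = inj₂ (touching⇒exchanged (u , lookup⇒∈ I[u] , edge))
        ... | false | true = inj₁ (touching⇒exchanged (w , lookup⇒∈ I[w] , trans (adj-sym G w u) edge))
        ... | false | false with S-cover u w edge
        ...   | inj₁ u∈S = inj₁ (lookup⇒∈ (trans (lookup-exchanged u) (cong₂ (λ s i → (s ∧ not i) ∨ touches u) (∈⇒lookup u∈S) I[u])))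
        ...   | inj₂ w∈S = inj₂ (lookup⇒∈ (trans (lookup-exchanged w) (cong₂ (λ s i → (s ∧ not i) ∨ touches w) (∈⇒lookup w∈S) I[w])))

        not-touching : ∀ u → lookup I u ≡ true → touches u ≡ false
        not-touching u I[u] = dec-false (touches? u) λ (w , w∈I , edge) → I-independent w u w∈I (lookup⇒∈ I[u]) edge

        exchange : weight x exchanged + weight x I ≡ weight x S + ⟦ touches v ⟧
        exchange = begin
          weight x exchanged + weight x I                            ≡⟨ sym (∑-+ (allFin n) _ _) ⟩
          ∑ (allFin n) (λ u → (if lookup exchanged u then x u else 0ℚ) + (if lookup I u then x u else 0ℚ))
                                                                     ≡⟨ ∑-cong (allFin n) pointwise ⟩
          ∑ (allFin n) (λ u → (if lookup S u then x u else 0ℚ) + pick _≟_ v (λ _ → ⟦ touches v ⟧) u)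
                                                                     ≡⟨ ∑-+ (allFin n) _ _ ⟩
          weight x S + ∑ (allFin n) (pick _≟_ v (λ _ → ⟦ touches v ⟧)) ≡⟨ cong (weight x S +_) (allFin-sifting n v _) ⟩
          weight x S + ⟦ touches v ⟧                                 ∎
          where
          open ≡-Reasoning
          -- By cases on u ∈ I and u ∈ S; outside S the point x agrees with 1_v.
          pointwise : ∀ u → (if lookup exchanged u then x u else 0ℚ) + (if lookup I u then x u else 0ℚ) ≡
                            (if lookup S u then x u else 0ℚ) + pick _≟_ v (λ _ → ⟦ touches v ⟧) u
          pointwise u rewrite lookup-exchanged u with lookup I u in I[u] | lookup S u in S[u]
          ... | true | false = ⊥-elim (false≢true (trans (sym S[u]) (I⊆S u I[u])))
          ... | true | true rewrite not-touching u I[u] | pick-≢ _≟_ v (λ _ → ⟦ touches v ⟧) u (v≢S u S[u]) =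
            trans (+-identityˡ (x u)) (sym (+-identityʳ (x u)))
          ... | false | true rewrite pick-≢ _≟_ v (λ _ → ⟦ touches v ⟧) u (v≢S u S[u]) = refl
          ... | false | false rewrite x-outside u S[u] | 𝟙≡pick v u with v ≟ u
          ...   | yes refl = +-comm ⟦ touches u ⟧ 0ℚ
          ...   | no _ with touches u
          ...     | true = refl
          ...     | false = refl

        -- Since S is no heavier than the exchanged cover: weight x I ≤ [v touches I].
        bound : weight x I ≤ ⟦ touches v ⟧
        bound = ≤-exchange (proj₂ (proj₂ x-feasible) exchanged exchanged-cover) exchange

      ⟦⟧≤1 : ∀ k → ⟦ k ⟧ ≤ 1ℚ
      ⟦⟧≤1 true = ≤-refl
      ⟦⟧≤1 false = 0≤1

      x-clique : FracCliqueFeasible G N x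
      x-clique = nonneg-on-N , classes≤1
        where
        nonneg-on-N : ∀ u → u ∈ N → 0ℚ ≤ x u
        nonneg-on-N u u∈N = subst (_≤ x u) (trans (𝟙≡pick v u) (pick-≢ _≟_ v _ u v≢u)) (proj₁ x-feasible u)
          where
          v≢u : v ≢ u
          v≢u refl = false≢true (trans (sym v∉N) (∈⇒lookup u∈N))
        classes≤1 : ∀ I → I ⊆ N → IsIndependent G I → weight x I ≤ 1ℚ
        classes≤1 I I⊆N I-independent =
          ≤-trans (Exchange.bound I (λ u I[u] → N⊆S u (∈⇒lookup (I⊆N (lookup⇒∈ I[u])))) I-independent) (⟦⟧≤1 _)

      -- A vertex of S that is not a neighbour of v has weight at most 0, since
      -- the singleton of it does not touch v.
      x-nonpositive : ∀ w → lookup S w ≡ true → lookup N w ≡ false → x w ≤ 0ℚ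
      x-nonpositive w S[w] N[w] = subst₂ _≤_ (weight-⁅⁆ x w) (cong ⟦_⟧ (dec-false (touches? v) untouched)) bound
        where
        open Exchange ⁅ w ⁆ (λ u ⁅w⁆[u] → subst (λ z → lookup S z ≡ true) (sym (x∈⁅y⁆⇒x≡y w (lookup⇒∈ ⁅w⁆[u]))) S[w])
                            (⁅⁆-independent G w)
        untouched : ¬ Touches v
        untouched (w′ , w′∈⁅w⁆ , edge) rewrite x∈⁅y⁆⇒x≡y w w′∈⁅w⁆ =
          false≢true (trans (sym N[w]) (trans N[ w ] (trans (adj-sym G v w) edge)))

      S-to-N : weight x S ≤ weight x N
      S-to-N = ∑-mono (allFin n) pointwise
        where
        pointwise : ∀ u → (if lookup S u then x u else 0ℚ) ≤ (if lookup N u then x u else 0ℚ)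
        pointwise u with lookup N u in N[u] | lookup S u in S[u]
        ... | true  | true  = ≤-refl
        ... | true  | false = ⊥-elim (false≢true (trans (sym S[u]) (N⊆S u N[u])))
        ... | false | true  = x-nonpositive u S[u] N[u]
        ... | false | false = ≤-refl

      upper-bound : weight x S ≤ value
      upper-bound = ≤-trans S-to-N (proj₂ (is-fractional-clique-number G N (equal-weights G N)) x x-clique)

    ν-is-fractional-clique-number : IsNu G (𝟙 v) S value
    ν-is-fractional-clique-number = (point , point-feasible , point-weight) , (λ x x-feasible → upper-bound x-feasible)

open FractionalClique using (EqualWeights; equal-weights;
  is-fractional-clique-number; is-fractional-chromatic-number)
open Neighbourhood using (ν-is-fractional-clique-number)

proposition2 : ∀ (n : ℕ) (G : Graph n) → NoIsolatedVertices G →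
    ∀ (v : Fin n) (S : Subset n) → IsChosenCover G (𝟙 v) S →
    Σ ℚ λ α → IsNu G (𝟙 v) S α
    × IsFracCliqueNumber G (Nbhd G v) α
    × IsFracChromaticNumber G (Nbhd G v) α
proposition2 n G _ v S S-chosen =
  EqualWeights.value optimum ,
  ν-is-fractional-clique-number G v S S-chosen ,
  is-fractional-clique-number G (Nbhd G v) optimum ,
  is-fractional-chromatic-number G (Nbhd G v) optimum
  where
  optimum : EqualWeights G (Nbhd G v)
  optimum = equal-weights G (Nbhd G v)
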